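{- Let $2 \le k \le 4$. If $m \ge 2$ and $n \ge k+1$, then $$d_k(P_m \Box P_n) = \left\lceil \frac{mn}{k+1} \right\rceil.$$
   Context: $P_n$ is the path on $n$ vertices; $P_m \Box P_n$ is the Cartesian product ($m\times n$ grid): vertices $(i,j)$, $0\le i\le m-1$, $0\le j\le n-1$, with $(i,j)$ adjacent to $(i',j')$ iff ($|i-i'|=1$ and $j=j'$) or ($i=i'$ and $|j-j'|=1$). The $k$-move deduction game ($k$ a positive integer) on a finite graph $G$: a layout places a finite number of searchers on vertices of $G$ (several searchers may share a vertex). Every searcher is initially mobile. A vertex is protected once it has been occupied by some searcher (so initially occupied vertices are protected); other vertices are unprotected. The game proceeds in stages. At each stage, for every vertex $v$ that has at least one unprotected neighbour: if the number of mobile searchers on $v$ is at least the number of unprotected neighbours of $v$, then the mobile searchers on $v$ move to the unprotected neighbours of $v$ so that each unprotected neighbour receives at least one searcher; excess mobile searchers on $v$ may also move to any of these unprotected neighbours. All moves in a stage happen simultaneously, newly occupied vertices become protected, and a searcher that has moved $k$ times becomes immobile. The process repeats until all vertices are protected or no searcher can move. A layout is successful if all vertices of $G$ end up protected. The $k$-move deduction number $d_k(G)$ is the minimum number of searchers in a successful layout on $G$. -}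

module Defs where

open import Data.Nat using (ℕ; zero; suc; _+_; _*_; _≤_; _<_; _<?_; _≤?_; ∣_-_∣)
import Data.Nat as ℕ
open import Data.Nat.DivMod using (_/_)
open import Data.Fin using (Fin; toℕ)
import Data.Fin as F
open import Data.Bool using (Bool; true; false; _∨_)
import Data.Bool as B
open import Data.List using (List; length; filter; allFin; cartesianProduct)
open import Data.Bool.ListAction using (any)
open import Data.Product using (Σ; ∃; _×_; _,_; proj₁; proj₂)
open import Data.Product.Properties using (≡-dec)
open import Data.Sum using (_⊎_)
open import Relation.Nullary using (Dec; ¬_; yes; no)
open import Relation.Nullary.Decidable using (⌊_⌋; _×-dec_; _⊎-dec_)
open import Relation.Binary.PropositionalEquality using (_≡_)

Vtx : ℕ → ℕ → Set
Vtx m n = Fin m × Fin n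

_≟V_ : ∀ {m n} (u v : Vtx m n) → Dec (u ≡ v)
_≟V_ = ≡-dec F._≟_ F._≟_

Adj : ∀ {m n} → Vtx m n → Vtx m n → Set
Adj (i , j) (i' , j') =
  (∣ toℕ i - toℕ i' ∣ ≡ 1 × j ≡ j') ⊎ (i ≡ i' × ∣ toℕ j - toℕ j' ∣ ≡ 1)

adj? : ∀ {m n} (u v : Vtx m n) → Dec (Adj u v)
adj? (i , j) (i' , j') =
  ((∣ toℕ i - toℕ i' ∣ ℕ.≟ 1) ×-dec (j F.≟ j'))
  ⊎-dec ((i F.≟ i') ×-dec (∣ toℕ j - toℕ j' ∣ ℕ.≟ 1))

allV : ∀ m n → List (Vtx m n)
allV m n = cartesianProduct (allFin m) (allFin n)

record Config (s m n : ℕ) : Set where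
  field
    pos  : Fin s → Vtx m n
    mv   : Fin s → ℕ
    prot : Vtx m n → Bool
open Config public

module Game (k : ℕ) {s m n : ℕ} where

  Unprot : Config s m n → Vtx m n → Set
  Unprot c w = prot c w ≡ false

  numUnprot : Config s m n → Vtx m n → ℕ
  numUnprot c v =
    length (filter (λ w → adj? v w ×-dec (prot c w B.≟ false)) (allV m n))

  Mobile : Config s m n → Fin s → Set
  Mobile c i = mv c i < k

  numMobileAt : Config s m n → Vtx m n → ℕ
  numMobileAt c v =
    length (filter (λ i → (pos c i ≟V v) ×-dec (mv c i <? k)) (allFin s))

  Fires : Config s m n → Vtx m n → Set
  Fires c v = 1 ≤ numUnprot c v × numUnprot c v ≤ numMobileAt c v

  record LegalStage (c : Config s m n) (dest : Fin s → Vtx m n) : Set where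
    field
      moveOK : ∀ i → dest i ≡ pos c i
                   ⊎ (Mobile c i × Fires c (pos c i)
                      × Adj (pos c i) (dest i) × Unprot c (dest i))
      cover  : ∀ v w → Fires c v → Adj v w → Unprot c w →
               ∃ λ i → pos c i ≡ v × dest i ≡ w × Mobile c i

  stage : Config s m n → (Fin s → Vtx m n) → Config s m n
  stage c dest = record
    { pos  = dest
    ; mv   = λ i → if ⌊ dest i ≟V pos c i ⌋ then mv c i else suc (mv c i)
    ; prot = λ w → prot c w ∨ any (λ i → ⌊ dest i ≟V w ⌋) (allFin s)
    }
    where open import Data.Bool using (if_then_else_)

  data Wins (c : Config s m n) : Set where
    done : (∀ v → prot c v ≡ true) → Wins c
    step : (dest : Fin s → Vtx m n) → LegalStage c dest →
           Wins (stage c dest) → Wins c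

initial : ∀ {s m n} → (Fin s → Vtx m n) → Config s m n
initial {s} L = record
  { pos  = L
  ; mv   = λ _ → 0
  ; prot = λ w → any (λ i → ⌊ L i ≟V w ⌋) (allFin s)
  }

Successful : (k : ℕ) {s m n : ℕ} → (Fin s → Vtx m n) → Set
Successful k L = Game.Wins k (initial L)

IsDeductionNumber : (k m n d : ℕ) → Set
IsDeductionNumber k m n d =
  (Σ (Fin d → Vtx m n) λ L → Successful k L)
  × (∀ s → s < d → (L : Fin s → Vtx m n) → ¬ Successful k L)

-- ⌈ a / (k+1) ⌉
ceilDivSuc : ℕ → ℕ → ℕ
ceilDivSuc a k = (a + k) / suc k

-- Lower bound: a searcher protects at most one new vertex per move and moves at most k times, so
-- s searchers protect at most s(k+1) vertices.
--
-- Upper bound: write m = a(k+1) + h and n = b(k+1) + w with a small corner of h rows and w columns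
-- (h, w ≤ k, except that w grows by k+1 when both remainders are at least 2).  Outside the corner
-- the grid is tiled by straight segments of k+1 vertices, each swept by one searcher; the corner gets
-- an explicit layout with ⌈hw/(k+1)⌉ searchers, checked by evaluation.  Any such plan (a
-- "schedule") is realised by the game: as long as the play follows the plan it is legal, and a rank
-- on the vertices, decreasing from the target of a move to the other unprotected neighbours of its
-- source, rules out the deadlock in which no vertex can fire.

module Submission where

open import Defs
open import Data.Nat using (ℕ; zero; suc; _+_; _*_; _∸_; _⊔_; _≤_; _<_; z≤n; s≤s; _<?_; _≤?_; ∣_-_∣; NonZero; >-nonZero)
import Data.Nat as ℕ
open import Data.Nat.Properties
open import Data.Nat.DivMod
  using (_%_; _/_; _mod_; m≡m%n+[m/n]*n; m%n<n; m<n⇒m%n≡m; [m+kn]%n≡m%n; m<n*o⇒m/o<n; m/n*n≤m; m*n/n≡m; +-distrib-/-∣ʳ; m≥n⇒m/n>0)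
open import Data.Nat.Divisibility using (n∣m*n)
open import Data.Nat.ListAction using (sum)
open import Data.Nat.Tactic.RingSolver using (solve-∀)
open import Data.Bool using (Bool; true; false; _∨_; _∧_; not; if_then_else_) renaming (_≟_ to _≟ᵇ_)
open import Data.Bool.Properties using (T?; T-≡; ∨-zeroʳ)
open import Data.Bool.ListAction using (any)
open import Data.Unit using (⊤; tt)
open import Data.Empty using (⊥-elim)
open import Data.Fin using (Fin; toℕ; fromℕ<)
import Data.Fin as Fin
open import Data.Fin.Properties using (toℕ-injective; toℕ<n; toℕ-fromℕ<; any?; all?; ¬∀⟶∃¬; +↔⊎; *↔×)
open import Data.List using (List; []; _∷_; _++_; [_]; length; filter; map; allFin; cartesianProduct; lookup; foldr; concat; upTo)
open import Data.List.Properties using (length-map; length-++; length-++-sucʳ; length-tabulate)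
open import Data.List.Membership.Propositional using (_∈_)
open import Data.List.Membership.Propositional.Properties
  using (∈-filter⁻; ∈-filter⁺; ∈-allFin; ∈-cartesianProduct⁺; ∈-map⁺; ∈-∃++; ∈-++⁻; ∈-++⁺ˡ; ∈-++⁺ʳ; ∈-length)
open import Data.List.Relation.Binary.Subset.Propositional using (_⊆_)
open import Data.List.Relation.Unary.Any using (Any; here; there; satisfied)
import Data.List.Relation.Unary.Any as Any
open import Data.List.Relation.Unary.Any.Properties using (any⁺; any⁻)
open import Data.List.Relation.Unary.All using (_∷_)
import Data.List.Relation.Unary.All as All
open import Data.List.Relation.Unary.Unique.Propositional using (Unique; _∷_)
import Data.List.Relation.Unary.Unique.Propositional.Properties as Unique
open import Data.Product using (Σ; ∃; ∃₂; _×_; _,_; proj₁; proj₂)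
open import Data.Product.Properties using (≡-dec)
open import Data.Sum using (_⊎_; inj₁; inj₂)
import Data.Sum as Sum
open import Data.Sum.Function.Propositional using (_⊎-↔_)
open import Function using (_∘_; _$_; id; _↔_; Inverse)
open import Function.Bundles using (Equivalence)
open import Function.Construct.Identity using (↔-id)
open import Function.Construct.Composition using (_↔-∘_)
open import Relation.Nullary using (Dec; yes; no; ¬_)
open import Relation.Nullary.Decidable using (⌊_⌋; toWitness; fromWitness; fromWitnessFalse; from-yes; _×-dec_; _⊎-dec_; _→-dec_; ¬?)
open import Relation.Binary.Definitions using (DecidableEquality)
open import Relation.Binary.PropositionalEquality
  using (_≡_; _≢_; refl; sym; trans; cong; cong₂; subst; subst₂; module ≡-Reasoning)

≡true⇒≢false : {b : Bool} → b ≡ true → b ≢ false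
≡true⇒≢false refl ()

∨-≡trueˡ : ∀ {a} b → a ≡ true → a ∨ b ≡ true
∨-≡trueˡ b refl = refl

∨-≡trueʳ : ∀ a {b} → b ≡ true → a ∨ b ≡ true
∨-≡trueʳ true  _    = refl
∨-≡trueʳ false refl = refl

module _ {A : Set} where

  Unique-⊆⇒length≤ : {xs ys : List A} → Unique xs → xs ⊆ ys → length xs ≤ length ys
  Unique-⊆⇒length≤ {[]} _ _ = z≤n
  Unique-⊆⇒length≤ {x ∷ xs} {ys} (x∉xs ∷ uxs) xxs⊆ys with ∈-∃++ (xxs⊆ys (here refl))
  ... | us , vs , refl = subst (suc (length xs) ≤_) (sym (length-++-sucʳ us x vs))
                           (s≤s (Unique-⊆⇒length≤ uxs xs⊆usvs))
    where
    xs⊆usvs : xs ⊆ us ++ vs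
    xs⊆usvs {y} y∈xs with ∈-++⁻ us (xxs⊆ys (there y∈xs))
    ... | inj₁ y∈us = ∈-++⁺ˡ y∈us
    ... | inj₂ (here refl) = ⊥-elim (All.lookup x∉xs y∈xs refl)
    ... | inj₂ (there y∈vs) = ∈-++⁺ʳ us y∈vs

  length≤1⇒∈-unique : {xs : List A} {x y : A} → length xs ≤ 1 → x ∈ xs → y ∈ xs → x ≡ y
  length≤1⇒∈-unique {_ ∷ []} _ (here refl) (here refl) = refl
  length≤1⇒∈-unique {_ ∷ _ ∷ _} (s≤s ()) _ _

  1≤length⇒∃∈ : {xs : List A} → 1 ≤ length xs → ∃ λ x → x ∈ xs
  1≤length⇒∃∈ {x ∷ _} _ = x , here refl

  Unique⇒∃≢ : DecidableEquality A → {xs : List A} → Unique xs → 2 ≤ length xs →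
              ∀ v → ∃ λ y → y ∈ xs × y ≢ v
  Unique⇒∃≢ _≟_ {_ ∷ []} _ (s≤s ()) _
  Unique⇒∃≢ _≟_ {x ∷ y ∷ _} ((x≢y ∷ _) ∷ _) _ v with x ≟ v
  ... | yes refl = y , there (here refl) , λ y≡x → x≢y (sym y≡x)
  ... | no x≢v   = x , here refl , x≢v

  length-cartesianProduct : {B : Set} (xs : List A) (ys : List B) →
                            length (cartesianProduct xs ys) ≡ length xs * length ys
  length-cartesianProduct [] ys = refl
  length-cartesianProduct (x ∷ xs) ys = begin
    length (map (x ,_) ys ++ cartesianProduct xs ys)  ≡⟨ length-++ (map (x ,_) ys) ⟩
    length (map (x ,_) ys) + length (cartesianProduct xs ys)
      ≡⟨ cong₂ _+_ (length-map (x ,_) ys) (length-cartesianProduct xs ys) ⟩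
    length ys + length xs * length ys  ∎
    where open ≡-Reasoning

  count : (A → Bool) → List A → ℕ
  count p xs = length (filter (T? ∘ p) xs)

  count-∨ : (p q : A → Bool) (xs : List A) →
            count (λ x → p x ∨ q x) xs ≤ count p xs + count (λ x → not (p x) ∧ q x) xs
  count-∨ p q [] = z≤n
  count-∨ p q (x ∷ xs) with p x | q x
  ... | true  | _     = s≤s (count-∨ p q xs)
  ... | false | true  = subst (suc (count (λ x → p x ∨ q x) xs) ≤_) (sym (+-suc _ _)) (s≤s (count-∨ p q xs))
  ... | false | false = count-∨ p q xs

  count-all : (p : A → Bool) (xs : List A) → (∀ x → p x ≡ true) → count p xs ≡ length xs
  count-all p [] _ = refl
  count-all p (x ∷ xs) all with p x | all x
  ... | true | _ = cong suc (count-all p xs all)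

  sum-map-if : (b : A → Bool) (v : A → ℕ) (xs : List A) →
               sum (map (λ x → if b x then v x else suc (v x)) xs) ≡ sum (map v xs) + count (λ x → not (b x)) xs
  sum-map-if b v [] = refl
  sum-map-if b v (x ∷ xs) with b x
  ... | true  = trans (cong (v x +_) (sum-map-if b v xs)) (sym (+-assoc (v x) _ _))
  ... | false = trans (cong (suc (v x) +_) (sum-map-if b v xs))
                      (trans (cong suc (sym (+-assoc (v x) _ _))) (sym (+-suc _ _)))

  sum-map-≤ : (v : A → ℕ) {k : ℕ} (xs : List A) → (∀ x → v x ≤ k) → sum (map v xs) ≤ length xs * k
  sum-map-≤ v [] _ = z≤n
  sum-map-≤ v (x ∷ xs) v≤k = +-mono-≤ (v≤k x) (sum-map-≤ v xs v≤k)

  sum-map-mono : (f g : A → ℕ) (xs : List A) → (∀ x → f x ≤ g x) → sum (map f xs) ≤ sum (map g xs)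
  sum-map-mono f g [] _ = z≤n
  sum-map-mono f g (x ∷ xs) f≤g = +-mono-≤ (f≤g x) (sum-map-mono f g xs f≤g)

  sum-map-< : (f g : A → ℕ) {x : A} (xs : List A) → (∀ x → f x ≤ g x) → x ∈ xs → f x < g x →
              sum (map f xs) < sum (map g xs)
  sum-map-< f g (_ ∷ xs) f≤g (here refl) fx<gx = +-mono-<-≤ fx<gx (sum-map-mono f g xs f≤g)
  sum-map-< f g (y ∷ xs) f≤g (there x∈xs) fx<gx = +-mono-≤-< (f≤g y) (sum-map-< f g xs f≤g x∈xs fx<gx)

length-allV : ∀ m n → length (allV m n) ≡ m * n
length-allV m n = trans (length-cartesianProduct (allFin m) (allFin n))
                        (cong₂ _*_ (length-tabulate {n = m} (λ i → i)) (length-tabulate {n = n} (λ j → j)))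

allV-complete : ∀ {m n} (v : Vtx m n) → v ∈ allV m n
allV-complete (i , j) = ∈-cartesianProduct⁺ (∈-allFin i) (∈-allFin j)

allV-unique : ∀ m n → Unique (allV m n)
allV-unique m n = Unique.cartesianProduct⁺ (Unique.allFin⁺ m) (Unique.allFin⁺ n)

module _ {s m n : ℕ} where

  occupied : (Fin s → Vtx m n) → Vtx m n → Bool
  occupied f w = any (λ i → ⌊ f i ≟V w ⌋) (allFin s)

  occupied-self : (f : Fin s → Vtx m n) (i : Fin s) → occupied f (f i) ≡ true
  occupied-self f i = Equivalence.to T-≡ (any⁺ _ (Any.map (λ { refl → fromWitness refl }) (∈-allFin i)))

  occupied⇒∃ : (f : Fin s → Vtx m n) {w : Vtx m n} → occupied f w ≡ true → ∃ λ i → f i ≡ w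
  occupied⇒∃ f occ with satisfied (any⁻ _ (allFin s) (Equivalence.from T-≡ occ))
  ... | i , fi≡w = i , toWitness fi≡w

-- The lower bound

module LowerBound (k : ℕ) {s m n : ℕ} where
  open Game k {s} {m} {n}

  totalMoves : Config s m n → ℕ
  totalMoves c = sum (map (mv c) (allFin s))

  record Accounted (c : Config s m n) : Set where
    field
      moves≤k       : ∀ i → mv c i ≤ k
      pos-protected : ∀ i → prot c (pos c i) ≡ true
      protected≤    : count (prot c) (allV m n) ≤ s + totalMoves c
  open Accounted

  accounted-initial : (L : Fin s → Vtx m n) → Accounted (initial L)
  accounted-initial L = record
    { moves≤k       = λ _ → z≤n
    ; pos-protected = occupied-self L
    ; protected≤    = begin
        count (occupied L) (allV m n)  ≤⟨ Unique-⊆⇒length≤ (Unique.filter⁺ _ (allV-unique m n)) occupied⊆ ⟩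
        length (map L (allFin s))      ≡⟨ length-map L (allFin s) ⟩
        length (allFin s)              ≡⟨ length-tabulate {n = s} (λ i → i) ⟩
        s                              ≡⟨ sym (+-identityʳ s) ⟩
        s + 0                          ≡⟨ cong (s +_) (sym (sum-map-0 (allFin s))) ⟩
        s + totalMoves (initial L)     ∎
    }
    where
    open ≤-Reasoning
    occupied⊆ : filter (T? ∘ occupied L) (allV m n) ⊆ map L (allFin s)
    occupied⊆ w∈ with occupied⇒∃ L (Equivalence.to T-≡ (proj₂ (∈-filter⁻ (T? ∘ occupied L) {xs = allV m n} w∈)))
    ... | i , refl = ∈-map⁺ L (∈-allFin i)
    sum-map-0 : (xs : List (Fin s)) → sum (map (λ _ → 0) xs) ≡ 0
    sum-map-0 [] = refl
    sum-map-0 (_ ∷ xs) = sum-map-0 xs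

  module _ {c : Config s m n} {dest : Fin s → Vtx m n} (legal : LegalStage c dest) (acc : Accounted c) where
    open LegalStage legal

    stays moved : Fin s → Bool
    stays i = ⌊ dest i ≟V pos c i ⌋
    moved i = not (stays i)

    newlyProtected : Vtx m n → Bool
    newlyProtected w = not (prot c w) ∧ occupied dest w

    moves≤k′ : ∀ i → mv (stage c dest) i ≤ k
    moves≤k′ i with dest i ≟V pos c i | moveOK i
    ... | yes _      | _                 = moves≤k acc i
    ... | no  moving | inj₁ stays        = ⊥-elim (moving stays)
    ... | no  _      | inj₂ (mobile , _) = mobile

    newly⊆moved : filter (T? ∘ newlyProtected) (allV m n) ⊆ map dest (filter (T? ∘ moved) (allFin s))
    newly⊆moved {w} w∈ with prot c w in unprotected
                          | Equivalence.to T-≡ (proj₂ (∈-filter⁻ (T? ∘ newlyProtected) {xs = allV m n} w∈))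
    ... | false | reached with occupied⇒∃ dest reached
    ... | i , refl with dest i ≟V pos c i
    ... | yes stayed = ⊥-elim (≡true⇒≢false (subst (λ v → prot c v ≡ true) (sym stayed) (pos-protected acc i)) unprotected)
    ... | no moving = ∈-map⁺ dest (∈-filter⁺ (T? ∘ moved) (∈-allFin i) (fromWitnessFalse moving))

    newly≤moved : count newlyProtected (allV m n) ≤ count moved (allFin s)
    newly≤moved = begin
      count newlyProtected (allV m n)
        ≤⟨ Unique-⊆⇒length≤ (Unique.filter⁺ _ (allV-unique m n)) newly⊆moved ⟩
      length (map dest (filter (T? ∘ moved) (allFin s)))
        ≡⟨ length-map dest (filter (T? ∘ moved) (allFin s)) ⟩
      count moved (allFin s)  ∎
      where open ≤-Reasoning

    accounted-stage : Accounted (stage c dest)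
    accounted-stage = record
      { moves≤k       = moves≤k′
      ; pos-protected = λ i → subst (λ b → prot c (dest i) ∨ b ≡ true) (sym (occupied-self dest i)) (∨-zeroʳ _)
      ; protected≤    = begin
          count (λ w → prot c w ∨ occupied dest w) (allV m n)
            ≤⟨ count-∨ (prot c) (occupied dest) (allV m n) ⟩
          count (prot c) (allV m n) + count newlyProtected (allV m n)
            ≤⟨ +-mono-≤ (protected≤ acc) newly≤moved ⟩
          s + totalMoves c + count moved (allFin s)
            ≡⟨ +-assoc s _ _ ⟩
          s + (totalMoves c + count moved (allFin s))
            ≡⟨ cong (s +_) (sym (sum-map-if stays (mv c) (allFin s))) ⟩
          s + totalMoves (stage c dest)  ∎
      }
      where open ≤-Reasoning

  winning⇒area≤ : ∀ c → Accounted c → Wins c → m * n ≤ s * suc k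
  winning⇒area≤ c acc (step dest legal w) = winning⇒area≤ (stage c dest) (accounted-stage legal acc) w
  winning⇒area≤ c acc (done allProtected) = begin
    m * n                          ≡⟨ sym (length-allV m n) ⟩
    length (allV m n)              ≡⟨ sym (count-all (prot c) (allV m n) allProtected) ⟩
    count (prot c) (allV m n)      ≤⟨ protected≤ acc ⟩
    s + totalMoves c               ≤⟨ +-monoʳ-≤ s (sum-map-≤ (mv c) (allFin s) (moves≤k acc)) ⟩
    s + length (allFin s) * k      ≡⟨ cong (λ l → s + l * k) (length-tabulate {n = s} (λ i → i)) ⟩
    s + s * k                      ≡⟨ sym (*-suc s k) ⟩
    s * suc k                      ∎
    where open ≤-Reasoning

successful⇒area≤ : ∀ k {s m n} (L : Fin s → Vtx m n) → Successful k L → m * n ≤ s * suc k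
successful⇒area≤ k L = LowerBound.winning⇒area≤ k (initial L) (LowerBound.accounted-initial k L)

<ceilDivSuc⇒unsuccessful : ∀ k {s m n} → s < ceilDivSuc (m * n) k → (L : Fin s → Vtx m n) → ¬ Successful k L
<ceilDivSuc⇒unsuccessful k {s} {m} {n} s<⌈mn/d⌉ L win = <⇒≱ s[k+1]<mn (successful⇒area≤ k L win)
  where
  open ≤-Reasoning
  s[k+1]<mn : s * suc k < m * n
  s[k+1]<mn = +-cancelʳ-< k (s * suc k) (m * n) $ begin-strict
    s * suc k + k                   <⟨ +-monoʳ-< (s * suc k) (n<1+n k) ⟩
    s * suc k + suc k               ≡⟨ +-comm (s * suc k) (suc k) ⟩
    suc s * suc k                   ≤⟨ *-monoˡ-≤ (suc k) s<⌈mn/d⌉ ⟩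
    (m * n + k) / suc k * suc k     ≤⟨ m/n*n≤m (m * n + k) (suc k) ⟩
    m * n + k                       ∎

-- Schedules

module Schedules {V : Set} (_~_ : V → V → Set) (In : V → Set)
                 {I : Set} (path : I → ℕ → V) (len : I → ℕ) where

  Start : V → Set
  Start x = ∃ λ i → path i 0 ≡ x

  SoleAt : I → ℕ → Set
  SoleAt i t = t ≡ 0 → ∀ i′ → path i′ 0 ≡ path i 0 → i′ ≡ i

  -- x ⊑ y: in the planned play x is protected no later than y.
  infix 4 _⊑_
  data _⊑_ : V → V → Set where
    start   : ∀ {x y} → Start x → x ⊑ y
    along   : ∀ i t → t < len i → path i t ⊑ path i (suc t)
    beside  : ∀ i t {y} → t < len i → In y → path i t ~ y → y ⊑ path i (suc t)
    ⊑-trans : ∀ {x y z} → x ⊑ y → y ⊑ z → x ⊑ z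

  -- A plan covering the region In: searcher i starts at path i 0 and its t-th move goes to
  -- path i t.  Paths meet only at common starts, whose neighbours are all first steps; a path
  -- stopping before k moves leaves nothing next to its end to protect later; and rank, increasing
  -- along paths and smaller at the other neighbours of a step's source, rules out deadlock.
  record Schedule (k : ℕ) : Set where
    field
      rank                : V → ℕ
      len≤k               : ∀ i → len i ≤ k
      path-in             : ∀ i t → t ≤ len i → In (path i t)
      path-adjacent       : ∀ i t → t < len i → path i t ~ path i (suc t)
      path-covers         : ∀ y → In y → ∃₂ λ i t → t ≤ len i × path i t ≡ y
      paths-meet-at-start : ∀ i i′ t t′ → t ≤ len i → t′ ≤ len i′ → path i t ≡ path i′ t′ →
                            t ≡ t′ × (t ≡ 0 ⊎ i ≡ i′)
      shared-start-fans   : ∀ i i′ → i ≢ i′ → path i 0 ≡ path i′ 0 → ∀ y → In y → path i 0 ~ y →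
                            Start y ⊎ ∃ λ i″ → path i″ 0 ≡ path i 0 × 1 ≤ len i″ × path i″ 1 ≡ y
      side-rank<          : ∀ i t → t < len i → SoleAt i t → ∀ y → In y → path i t ~ y →
                            y ≢ path i (suc t) → Start y ⊎ rank y < rank (path i (suc t))
      rank-increasing     : ∀ i t → 1 ≤ t → t < len i → rank (path i t) < rank (path i (suc t))
      early-end-covered   : ∀ i → len i < k → ∀ y → In y → path i (len i) ~ y → y ⊑ path i (len i)

module _ {V W : Set} {_~_ : V → V → Set} {_≈_ : W → W → Set} {In : V → Set} {In′ : W → Set}
         {I J : Set} {path : I → ℕ → V} {len : I → ℕ} {path′ : J → ℕ → W} {len′ : J → ℕ}
         (g : V → W) (f : I → J)
         (path-map : ∀ i t → path′ (f i) t ≡ g (path i t)) (len-map : ∀ i → len′ (f i) ≡ len i)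
         (In-map : ∀ {y} → In y → In′ (g y))
         (~-map : ∀ i t {y} → t ≤ len i → In y → path i t ~ y → g (path i t) ≈ g y) where

  open Schedules

  ⊑-map : ∀ {x y} → _⊑_ _~_ In path len x y → _⊑_ _≈_ In′ path′ len′ (g x) (g y)
  ⊑-map (start (i , refl)) = start (f i , path-map i 0)
  ⊑-map (along i t t<len) =
    subst₂ (_⊑_ _≈_ In′ path′ len′) (path-map i t) (path-map i (suc t))
           (along (f i) t (subst (t <_) (sym (len-map i)) t<len))
  ⊑-map (beside i t t<len iny adj) =
    subst (_⊑_ _≈_ In′ path′ len′ _) (path-map i (suc t))
          (beside (f i) t (subst (t <_) (sym (len-map i)) t<len) (In-map iny)
                  (subst (_≈ _) (sym (path-map i t)) (~-map i t (<⇒≤ t<len) iny adj)))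
  ⊑-map (⊑-trans x⊑y y⊑z) = ⊑-trans (⊑-map x⊑y) (⊑-map y⊑z)

-- Schedules on the grid are realised by the game

module Play (k : ℕ) {s m n : ℕ} {path : Fin s → ℕ → Vtx m n} {len : Fin s → ℕ}
            (S : Schedules.Schedule Adj (λ _ → ⊤) path len k) where
  open Schedules Adj (λ _ → ⊤) path len
  open Schedule S
  open Game k {s} {m} {n}

  rank-monotone : ∀ i a b → 1 ≤ a → a ≤ b → b ≤ len i → rank (path i a) ≤ rank (path i b)
  rank-monotone i a zero 1≤a a≤0 _ = ⊥-elim (<-irrefl refl (≤-trans 1≤a a≤0))
  rank-monotone i a (suc b) 1≤a a≤1+b 1+b≤len with m≤n⇒m<n∨m≡n a≤1+b
  ... | inj₂ refl = ≤-refl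
  ... | inj₁ a<1+b = ≤-trans (rank-monotone i a b 1≤a (≤-pred a<1+b) (<⇒≤ 1+b≤len))
                             (<⇒≤ (rank-increasing i b (≤-trans 1≤a (≤-pred a<1+b)) 1+b≤len))

  remaining : (Fin s → ℕ) → ℕ
  remaining j = sum (map (λ i → len i ∸ j i) (allFin s))

  record Follows (c : Config s m n) (j : Fin s → ℕ) : Set where
    field
      j≤len             : ∀ i → j i ≤ len i
      pos≡path          : ∀ i → pos c i ≡ path i (j i)
      mv≡j              : ∀ i → mv c i ≡ j i
      protected⇒visited : ∀ v → prot c v ≡ true → ∃₂ λ i t → t ≤ j i × path i t ≡ v
      visited⇒protected : ∀ i t → t ≤ j i → prot c (path i t) ≡ true
      step-closed       : ∀ i t → t < len i → ∀ x → Adj (path i t) x →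
                          prot c (path i (suc t)) ≡ true → prot c x ≡ true

  module Stage {c : Config s m n} {j : Fin s → ℕ} (F : Follows c j) where
    open Follows F

    next : Fin s → Vtx m n
    next i = path i (suc (j i))

    mobile : ∀ i → j i < len i → Mobile c i
    mobile i j<len = subst (_< k) (sym (mv≡j i)) (≤-trans j<len (len≤k i))

    start-protected : ∀ {x} → Start x → prot c x ≡ true
    start-protected (i , refl) = visited⇒protected i 0 z≤n

    protected-step⇒passed : ∀ i t → t < len i → prot c (path i (suc t)) ≡ true → suc t ≤ j i
    protected-step⇒passed i t t<len protected with protected⇒visited _ protected
    ... | i′ , t′ , t′≤j , same with paths-meet-at-start i′ i t′ (suc t) (≤-trans t′≤j (j≤len i′)) t<len same
    ... | refl , inj₂ refl = t′≤j

    next-unprotected : ∀ i → j i < len i → prot c (next i) ≡ false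
    next-unprotected i j<len with prot c (next i) in protected
    ... | true  = ⊥-elim (<-irrefl refl (protected-step⇒passed i (j i) j<len protected))
    ... | false = refl

    ⊑-protected : ∀ {x y} → x ⊑ y → prot c y ≡ true → prot c x ≡ true
    ⊑-protected (start st) _ = start-protected st
    ⊑-protected (along i t t<len) p = visited⇒protected i t (<⇒≤ (protected-step⇒passed i t t<len p))
    ⊑-protected (beside i t t<len _ adj) p = step-closed i t t<len _ adj p
    ⊑-protected (⊑-trans x⊑y y⊑z) p = ⊑-protected x⊑y (⊑-protected y⊑z p)

    unprotectedNbrs : Vtx m n → List (Vtx m n)
    unprotectedNbrs u = filter (λ w → adj? u w ×-dec (prot c w ≟ᵇ false)) (allV m n)

    mobilesAt : Vtx m n → List (Fin s)
    mobilesAt u = filter (λ i → (pos c i ≟V u) ×-dec (mv c i <? k)) (allFin s)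

    ∈-unprotectedNbrs : ∀ {u w} → Adj u w → prot c w ≡ false → w ∈ unprotectedNbrs u
    ∈-unprotectedNbrs adj unprotected = ∈-filter⁺ _ (allV-complete _) (adj , unprotected)

    ∈-unprotectedNbrs⁻ : ∀ {u w} → w ∈ unprotectedNbrs u → Adj u w × prot c w ≡ false
    ∈-unprotectedNbrs⁻ {u} w∈ = proj₂ (∈-filter⁻ (λ w → adj? u w ×-dec (prot c w ≟ᵇ false)) {xs = allV m n} w∈)

    ∈-mobilesAt : ∀ {u i} → pos c i ≡ u → Mobile c i → i ∈ mobilesAt u
    ∈-mobilesAt at mob = ∈-filter⁺ _ (∈-allFin _) (at , mob)

    ∈-mobilesAt⁻ : ∀ {u i} → i ∈ mobilesAt u → pos c i ≡ u × Mobile c i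
    ∈-mobilesAt⁻ {u} i∈ = proj₂ (∈-filter⁻ (λ i → (pos c i ≟V u) ×-dec (mv c i <? k)) {xs = allFin s} i∈)

    Moves : Fin s → Set
    Moves i = Fires c (pos c i) × j i < len i

    moves? : ∀ i → Dec (Moves i)
    moves? i = ((1 ≤? numUnprot c (pos c i)) ×-dec (numUnprot c (pos c i) ≤? numMobileAt c (pos c i)))
               ×-dec (j i <? len i)

    j′ : Fin s → ℕ
    j′ i with moves? i
    ... | yes _ = suc (j i)
    ... | no  _ = j i

    dest : Fin s → Vtx m n
    dest i = path i (j′ i)

    j′-moving : ∀ {i} → Moves i → j′ i ≡ suc (j i)
    j′-moving {i} moving with moves? i
    ... | yes _       = refl
    ... | no  ¬moving = ⊥-elim (¬moving moving)

    dest-moving : ∀ {i} → Moves i → dest i ≡ next i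
    dest-moving {i} moving = cong (path i) (j′-moving moving)

    Shared : Fin s → Set
    Shared i = j i ≡ 0 × ∃ λ i′ → i′ ≢ i × path i′ 0 ≡ path i 0

    sole-or-shared : ∀ i → SoleAt i (j i) ⊎ Shared i
    sole-or-shared i with j i ≟ 0 | any? (λ i′ → ¬? (i′ Fin.≟ i) ×-dec (path i′ 0 ≟V path i 0))
    ... | no j≢0   | _         = inj₁ (λ j≡0 → ⊥-elim (j≢0 j≡0))
    ... | yes j≡0  | yes other = inj₂ (j≡0 , other)
    ... | yes _    | no none   = inj₁ alone
      where
      alone : SoleAt i (j i)
      alone _ i′ same with i′ Fin.≟ i
      ... | yes i′≡i = i′≡i
      ... | no  i′≢i = ⊥-elim (none (i′ , i′≢i , same))

    sole⇒alone : ∀ i → SoleAt i (j i) → ∀ i′ → pos c i′ ≡ pos c i → i′ ≡ i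
    sole⇒alone i sole i′ same
      with paths-meet-at-start i′ i (j i′) (j i) (j≤len i′) (j≤len i)
             (trans (sym (pos≡path i′)) (trans same (pos≡path i)))
    ... | _         , inj₂ i′≡i  = i′≡i
    ... | ji′≡ji , inj₁ ji′≡0 = sole ji≡0 i′ (begin
      path i′ 0      ≡⟨ cong (path i′) (sym ji′≡0) ⟩
      path i′ (j i′) ≡⟨ sym (pos≡path i′) ⟩
      pos c i′       ≡⟨ same ⟩
      pos c i        ≡⟨ pos≡path i ⟩
      path i (j i)   ≡⟨ cong (path i) ji≡0 ⟩
      path i 0       ∎)
      where
      open ≡-Reasoning
      ji≡0 : j i ≡ 0
      ji≡0 = trans (sym ji′≡ji) ji′≡0

    fan-out : ∀ i → Shared i → ∀ y → Adj (pos c i) y → prot c y ≡ false →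
              ∃ λ i″ → pos c i″ ≡ pos c i × j i″ < len i″ × next i″ ≡ y
    fan-out i (j≡0 , i′ , i′≢i , same) y adj unprotected
      with shared-start-fans i′ i i′≢i same y tt (subst (λ u → Adj u y) pos≡start′ adj)
      where
      pos≡start′ : pos c i ≡ path i′ 0
      pos≡start′ = trans (pos≡path i) (trans (cong (path i) j≡0) (sym same))
    ... | inj₁ st = ⊥-elim (≡true⇒≢false (start-protected st) unprotected)
    ... | inj₂ (i″ , start≡ , 1≤len , first≡y) = i″ , pos≡ , j″<len , next≡y
      where
      j″≡0 : j i″ ≡ 0
      j″≡0 with j i″ in eq
      ... | zero  = refl
      ... | suc _ = ⊥-elim (≡true⇒≢false
              (subst (λ v → prot c v ≡ true) first≡y (visited⇒protected i″ 1 (subst (1 ≤_) (sym eq) (s≤s z≤n))))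
              unprotected)
      pos≡ : pos c i″ ≡ pos c i
      pos≡ = trans (pos≡path i″) (trans (cong (path i″) j″≡0)
               (trans start≡ (trans same (sym (trans (pos≡path i) (cong (path i) j≡0))))))
      j″<len : j i″ < len i″
      j″<len = subst (_< len i″) (sym j″≡0) 1≤len
      next≡y : next i″ ≡ y
      next≡y = trans (cong (λ t → path i″ (suc t)) j″≡0) first≡y

    some-mobile : ∀ {u} → Fires c u → ∃ λ i → pos c i ≡ u × Mobile c i
    some-mobile (1≤unprotected , unprotected≤mobiles) =
      let (i , i∈) = 1≤length⇒∃∈ (≤-trans 1≤unprotected unprotected≤mobiles) in i , ∈-mobilesAt⁻ i∈

    unprotected-nbr⇒unfinished : ∀ {i x} → Mobile c i → Adj (pos c i) x → prot c x ≡ false → j i < len i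
    unprotected-nbr⇒unfinished {i} {x} mob adj unprotected with m≤n⇒m<n∨m≡n (j≤len i)
    ... | inj₁ j<len = j<len
    ... | inj₂ j≡len = ⊥-elim (≡true⇒≢false (⊑-protected x⊑end end-protected) unprotected)
      where
      len<k : len i < k
      len<k = subst (_< k) (trans (mv≡j i) j≡len) mob
      x⊑end : x ⊑ path i (len i)
      x⊑end = early-end-covered i len<k x tt (subst (λ u → Adj u x) (trans (pos≡path i) (cong (path i) j≡len)) adj)
      end-protected : prot c (path i (len i)) ≡ true
      end-protected = visited⇒protected i (len i) (≤-reflexive (sym j≡len))

    next-adjacent : ∀ i → j i < len i → Adj (pos c i) (next i)
    next-adjacent i j<len = subst (λ u → Adj u (next i)) (sym (pos≡path i)) (path-adjacent i (j i) j<len)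

    cover : ∀ u x → Fires c u → Adj u x → prot c x ≡ false →
            ∃ λ i → pos c i ≡ u × dest i ≡ x × Mobile c i
    cover u x fires adj unprotected with some-mobile fires
    ... | i , refl , mob with sole-or-shared i
    ... | inj₂ shared =
      let (i″ , at , j<len , next≡x) = fan-out i shared x adj unprotected
      in  i″ , at , trans (dest-moving (subst (Fires c) (sym at) fires , j<len)) next≡x , mobile i″ j<len
    ... | inj₁ sole = i , refl , trans (dest-moving (fires , j<len)) (sym x≡next) , mob
      where
      j<len : j i < len i
      j<len = unprotected-nbr⇒unfinished mob adj unprotected
      mobiles≤1 : numMobileAt c (pos c i) ≤ 1
      mobiles≤1 = Unique-⊆⇒length≤ {ys = [ i ]} (Unique.filter⁺ _ (Unique.allFin⁺ s))
                    (λ i′∈ → here (sole⇒alone i sole _ (proj₁ (∈-mobilesAt⁻ i′∈))))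
      x≡next : x ≡ next i
      x≡next = length≤1⇒∈-unique (≤-trans (proj₂ fires) mobiles≤1) (∈-unprotectedNbrs adj unprotected)
                 (∈-unprotectedNbrs (next-adjacent i j<len) (next-unprotected i j<len))

    legal : LegalStage c dest
    legal = record { moveOK = moveOK ; cover = cover }
      where
      moveOK : ∀ i → dest i ≡ pos c i ⊎ (Mobile c i × Fires c (pos c i) × Adj (pos c i) (dest i) × Unprot c (dest i))
      moveOK i with moves? i
      ... | no _ = inj₁ (sym (pos≡path i))
      ... | yes (fires , j<len) = inj₂ (mobile i j<len , fires , next-adjacent i j<len , next-unprotected i j<len)

    j≤j′ : ∀ i → j i ≤ j′ i
    j≤j′ i with moves? i
    ... | yes _ = n≤1+n (j i)
    ... | no  _ = ≤-refl

    newly-visited : ∀ i t → t ≤ j′ i → ¬ t ≤ j i → t ≡ suc (j i) × Moves i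
    newly-visited i t t≤j′ t≰j with moves? i
    ... | yes moving = ≤-antisym t≤j′ (≰⇒> t≰j) , moving
    ... | no  _      = ⊥-elim (t≰j t≤j′)

    c′ : Config s m n
    c′ = stage c dest

    j′≤len : ∀ i → j′ i ≤ len i
    j′≤len i with moves? i
    ... | yes (_ , j<len) = j<len
    ... | no  _           = j≤len i

    mv≡j′ : ∀ i → mv c′ i ≡ j′ i
    mv≡j′ i with moves? i
    mv≡j′ i | yes (_ , j<len) with path i (suc (j i)) ≟V pos c i
    ... | yes next≡pos = ⊥-elim (1+n≢n (proj₁ (paths-meet-at-start i i (suc (j i)) (j i) j<len (j≤len i)
                                                 (trans next≡pos (pos≡path i)))))
    ... | no _ = cong suc (mv≡j i)
    mv≡j′ i | no _ with path i (j i) ≟V pos c i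
    ... | yes _    = mv≡j i
    ... | no  ≢pos = ⊥-elim (≢pos (sym (pos≡path i)))

    protected′-cases : ∀ v → prot c′ v ≡ true → prot c v ≡ true ⊎ (prot c v ≡ false × ∃ λ i → dest i ≡ v)
    protected′-cases v p with prot c v
    ... | true  = inj₁ refl
    ... | false = inj₂ (refl , occupied⇒∃ dest p)

    protected⇒visited′ : ∀ v → prot c′ v ≡ true → ∃₂ λ i t → t ≤ j′ i × path i t ≡ v
    protected⇒visited′ v p with protected′-cases v p
    ... | inj₁ old = let (i , t , t≤j , eq) = protected⇒visited v old in i , t , ≤-trans t≤j (j≤j′ i) , eq
    ... | inj₂ (_ , i , eq) = i , j′ i , ≤-refl , eq

    visited⇒protected′ : ∀ i t → t ≤ j′ i → prot c′ (path i t) ≡ true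
    visited⇒protected′ i t t≤j′ with t ≤? j i
    ... | yes t≤j = ∨-≡trueˡ _ (visited⇒protected i t t≤j)
    ... | no  t≰j = ∨-≡trueʳ _ (subst (λ t → occupied dest (path i t) ≡ true) j′≡t (occupied-self dest i))
      where
      j′≡t : j′ i ≡ t
      j′≡t = let (t≡1+j , moving) = newly-visited i t t≤j′ t≰j in trans (j′-moving moving) (sym t≡1+j)

    fired⇒nbrs-protected : ∀ {u x} → Fires c u → Adj u x → prot c′ x ≡ true
    fired⇒nbrs-protected {u} {x} fires adj with prot c x in px
    ... | true  = refl
    ... | false = let (i , _ , dest≡x , _) = cover u x fires adj px
                  in  subst (λ v → occupied dest v ≡ true) dest≡x (occupied-self dest i)

    newly-reached⇒fired : ∀ i t → t < len i → prot c (path i (suc t)) ≡ false →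
                          ∀ i′ → dest i′ ≡ path i (suc t) → Fires c (path i t)
    newly-reached⇒fired i t t<len unprotected i′ dest≡
      with paths-meet-at-start i′ i (j′ i′) (suc t) (j′≤len i′) t<len dest≡
    ... | j′≡1+t , inj₁ j′≡0 = ⊥-elim (1+n≢0 (trans (sym j′≡1+t) j′≡0))
    ... | j′≡1+t , inj₂ refl =
      let (1+t≡1+j , fires , _) = newly-visited i (suc t) (≤-reflexive (sym j′≡1+t)) unvisited
      in  subst (Fires c) (trans (pos≡path i) (cong (path i) (sym (suc-injective 1+t≡1+j)))) fires
      where
      unvisited : ¬ suc t ≤ j i
      unvisited 1+t≤j = ≡true⇒≢false (visited⇒protected i (suc t) 1+t≤j) unprotected

    step-closed′ : ∀ i t → t < len i → ∀ x → Adj (path i t) x → prot c′ (path i (suc t)) ≡ true → prot c′ x ≡ true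
    step-closed′ i t t<len x adj p with protected′-cases _ p
    ... | inj₁ old = ∨-≡trueˡ _ (step-closed i t t<len x adj old)
    ... | inj₂ (unprotected , i′ , dest≡) =
      fired⇒nbrs-protected (newly-reached⇒fired i t t<len unprotected i′ dest≡) adj

    follows′ : Follows c′ j′
    follows′ = record
      { j≤len             = j′≤len
      ; pos≡path          = λ _ → refl
      ; mv≡j              = mv≡j′
      ; protected⇒visited = protected⇒visited′
      ; visited⇒protected = visited⇒protected′
      ; step-closed       = step-closed′
      }

    next-pending : ∀ o → j o < len o → 1 ≤ numUnprot c (pos c o)
    next-pending o j<len = ∈-length (∈-unprotectedNbrs (next-adjacent o j<len) (next-unprotected o j<len))

    fires-or-lower : ∀ o → j o < len o →
                     Fires c (pos c o) ⊎ ∃ λ y → prot c y ≡ false × rank y < rank (next o)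
    fires-or-lower o j<len with sole-or-shared o
    ... | inj₂ shared = inj₁ (next-pending o j<len , unprotected≤mobiles)
      where
      open ≤-Reasoning
      u = pos c o
      nbrs⊆ : unprotectedNbrs u ⊆ map next (mobilesAt u)
      nbrs⊆ y∈ =
        let (adj , unprotected) = ∈-unprotectedNbrs⁻ y∈
            (i , at , j<len′ , next≡y) = fan-out o shared _ adj unprotected
        in  subst (_∈ map next (mobilesAt u)) next≡y (∈-map⁺ next (∈-mobilesAt at (mobile i j<len′)))
      unprotected≤mobiles : numUnprot c u ≤ numMobileAt c u
      unprotected≤mobiles = begin
        numUnprot c u                    ≤⟨ Unique-⊆⇒length≤ (Unique.filter⁺ _ (allV-unique m n)) nbrs⊆ ⟩
        length (map next (mobilesAt u))  ≡⟨ length-map next (mobilesAt u) ⟩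
        numMobileAt c u                  ∎
    ... | inj₁ sole with numUnprot c (pos c o) ≤? 1
    ... | yes ≤1 = inj₁ (next-pending o j<len , ≤-trans ≤1 (∈-length (∈-mobilesAt refl (mobile o j<len))))
    ... | no  ≰1 with Unique⇒∃≢ _≟V_ (Unique.filter⁺ _ (allV-unique m n)) (≰⇒> ≰1) (next o)
    ... | y , y∈ , y≢next with ∈-unprotectedNbrs⁻ y∈
    ... | adj , unprotected
      with side-rank< o (j o) j<len sole y tt (subst (λ u → Adj u y) (pos≡path o) adj) y≢next
    ... | inj₁ st    = ⊥-elim (≡true⇒≢false (start-protected st) unprotected)
    ... | inj₂ lower = inj₂ (y , unprotected , lower)

    progress : ∀ r v → rank v < r → prot c v ≡ false → ∃ Moves
    progress (suc r) v rank<1+r unprotected with path-covers v tt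
    ... | o , t , t≤len , refl with j o <? t
    ... | no  j≮t = ⊥-elim (≡true⇒≢false (visited⇒protected o t (≮⇒≥ j≮t)) unprotected)
    ... | yes j<t with fires-or-lower o (<-≤-trans j<t t≤len)
    ... | inj₁ fires = o , fires , <-≤-trans j<t t≤len
    ... | inj₂ (y , unprotected′ , y<next) = progress r y y<r unprotected′
      where
      y<r : rank y < r
      y<r = <-≤-trans y<next (≤-trans (rank-monotone o (suc (j o)) t (s≤s z≤n) j<t t≤len) (≤-pred rank<1+r))

    remaining-decreases : ∀ o → Moves o → remaining j′ < remaining j
    remaining-decreases o moving@(_ , j<len) =
      sum-map-< (λ i → len i ∸ j′ i) (λ i → len i ∸ j i) (allFin s) shrinks (∈-allFin o)
        (subst (λ t → len o ∸ t < len o ∸ j o) (sym (j′-moving moving)) (∸-monoʳ-< ≤-refl j<len))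
      where
      shrinks : ∀ i → len i ∸ j′ i ≤ len i ∸ j i
      shrinks i = ∸-monoʳ-≤ (len i) (j≤j′ i)

  wins : ∀ fuel c j → Follows c j → remaining j < fuel → Wins c
  wins (suc fuel) c j F remaining<1+fuel with all? (λ i → len i ≤? j i)
  ... | yes finished = done λ v →
    let (i , t , t≤len , eq) = path-covers v tt
    in  subst (λ v → prot c v ≡ true) eq (Follows.visited⇒protected F i t (≤-trans t≤len (finished i)))
  ... | no unfinished =
    let (i , len≰j) = ¬∀⟶∃¬ s _ (λ i → len i ≤? j i) unfinished
        (o , moving) = progress (suc (rank (next i))) (next i) ≤-refl (next-unprotected i (≰⇒> len≰j))
    in  step dest legal (wins fuel _ _ follows′ (<-≤-trans (remaining-decreases o moving) (≤-pred remaining<1+fuel)))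
    where open Stage F

  follows-initial : Follows (initial (λ i → path i 0)) (λ _ → 0)
  follows-initial = record
    { j≤len             = λ _ → z≤n
    ; pos≡path          = λ _ → refl
    ; mv≡j              = λ _ → refl
    ; protected⇒visited = λ v p → let (i , eq) = occupied⇒∃ (λ i → path i 0) p in i , 0 , z≤n , eq
    ; visited⇒protected = λ { i zero _ → occupied-self (λ i → path i 0) i }
    ; step-closed       = λ i t t<len x _ p →
        let (i′ , eq) = occupied⇒∃ (λ i → path i 0) p
        in  ⊥-elim (1+n≢0 (sym (proj₁ (paths-meet-at-start i′ i 0 (suc t) z≤n t<len eq))))
    }

  schedule-wins : Successful k (λ i → path i 0)
  schedule-wins = wins (suc (remaining (λ _ → 0))) _ _ follows-initial ≤-refl

module _ {V : Set} {_~_ : V → V → Set} {In : V → Set} {I J : Set} {path : I → ℕ → V} {len : I → ℕ}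
         {k : ℕ} (e : J ↔ I) where
  open Inverse e
  open Schedules

  reindex : Schedule _~_ In path len k → Schedule _~_ In (path ∘ to) (len ∘ to) k
  reindex S = record
    { rank                = rank
    ; len≤k               = len≤k ∘ to
    ; path-in             = path-in ∘ to
    ; path-adjacent       = path-adjacent ∘ to
    ; path-covers         = λ y iny →
        let (i , t , t≤len , eq) = path-covers y iny
        in  from i , t , subst (λ i → t ≤ len i) (sym (to∘from i)) t≤len , trans (path-to∘from i t) eq
    ; paths-meet-at-start = λ j j′ t t′ t≤ t′≤ eq →
        let (t≡t′ , where-met) = paths-meet-at-start (to j) (to j′) t t′ t≤ t′≤ eq
        in  t≡t′ , Sum.map id to-injective where-met
    ; shared-start-fans   = λ j j′ j≢j′ eq y iny adj →
        Sum.map start⇒ (λ (i″ , start≡ , 1≤len , first≡y) →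
                      from i″ , trans (path-to∘from i″ 0) start≡ ,
                      subst (1 ≤_) (sym (cong len (to∘from i″))) 1≤len , trans (path-to∘from i″ 1) first≡y)
            (shared-start-fans (to j) (to j′) (j≢j′ ∘ to-injective) eq y iny adj)
    ; side-rank<          = λ j t t<len sole y iny adj y≢ →
        Sum.map start⇒ id (side-rank< (to j) t t<len (sole⇒ j t sole) y iny adj y≢)
    ; rank-increasing     = rank-increasing ∘ to
    ; early-end-covered   = λ j len<k y iny adj →
        ⊑-map id from path-to∘from (λ i → cong len (to∘from i)) id (λ i t _ _ adj → adj)
              (early-end-covered (to j) len<k y iny adj)
    }
    where
    open Schedule S
    to∘from : ∀ i → to (from i) ≡ i
    to∘from = strictlyInverseˡ
    to-injective : ∀ {j j′} → to j ≡ to j′ → j ≡ j′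
    to-injective {j} {j′} eq = trans (sym (strictlyInverseʳ j)) (trans (cong from eq) (strictlyInverseʳ j′))
    path-to∘from : ∀ i t → path (to (from i)) t ≡ path i t
    path-to∘from i t = cong (λ i → path i t) (to∘from i)
    start⇒ : ∀ {y} → Start _~_ In path len y → Start _~_ In (path ∘ to) (len ∘ to) y
    start⇒ (i , eq) = from i , trans (path-to∘from i 0) eq
    sole⇒ : ∀ j t → SoleAt _~_ In (path ∘ to) (len ∘ to) j t → SoleAt _~_ In path len (to j) t
    sole⇒ j t sole t≡0 i′ eq = trans (sym (to∘from i′)) (cong to (sole t≡0 (from i′) (trans (path-to∘from i′ 0) eq)))

-- Adj on unbounded coordinates, so that layouts can be described without bounds proofs.
Adjℕ : ℕ × ℕ → ℕ × ℕ → Set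
Adjℕ (r , c) (r′ , c′) = (∣ r - r′ ∣ ≡ 1 × c ≡ c′) ⊎ (r ≡ r′ × ∣ c - c′ ∣ ≡ 1)

InRect : ℕ → ℕ → ℕ × ℕ → Set
InRect h w (r , c) = r < h × c < w

inRect? : ∀ h w y → Dec (InRect h w y)
inRect? h w (r , c) = (r <? h) ×-dec (c <? w)

toℕ-mod : ∀ {r} d .{{_ : NonZero d}} → r < d → toℕ (r mod d) ≡ r
toℕ-mod d r<d = trans (toℕ-fromℕ< _) (m<n⇒m%n≡m r<d)

module _ {m n : ℕ} .{{_ : NonZero m}} .{{_ : NonZero n}} where

  toV : ℕ × ℕ → Vtx m n
  toV (r , c) = r mod m , c mod n

  toN : Vtx m n → ℕ × ℕ
  toN (i , j) = toℕ i , toℕ j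

  toN-inRect : ∀ v → InRect m n (toN v)
  toN-inRect (i , j) = toℕ<n i , toℕ<n j

  toN-toV : ∀ {y} → InRect m n y → toN (toV y) ≡ y
  toN-toV (r<m , c<n) = cong₂ _,_ (toℕ-mod m r<m) (toℕ-mod n c<n)

  toV-toN : ∀ v → toV (toN v) ≡ v
  toV-toN v = toN-injective (toN-toV (toN-inRect v))
    where
    toN-injective : ∀ {v v′} → toN v ≡ toN v′ → v ≡ v′
    toN-injective eq = cong₂ _,_ (toℕ-injective (cong proj₁ eq)) (toℕ-injective (cong proj₂ eq))

  toV-injective : ∀ {y z} → InRect m n y → InRect m n z → toV y ≡ toV z → y ≡ z
  toV-injective iny inz eq = trans (sym (toN-toV iny)) (trans (cong toN eq) (toN-toV inz))

  Adj⇒Adjℕ : ∀ {v x} → Adj v x → Adjℕ (toN v) (toN x)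
  Adj⇒Adjℕ (inj₁ (d , j≡j′)) = inj₁ (d , cong toℕ j≡j′)
  Adj⇒Adjℕ (inj₂ (i≡i′ , d)) = inj₂ (cong toℕ i≡i′ , d)

  Adjℕ⇒Adj : ∀ {y z} → InRect m n y → InRect m n z → Adjℕ y z → Adj (toV y) (toV z)
  Adjℕ⇒Adj iny inz adj with subst₂ Adjℕ (sym (toN-toV iny)) (sym (toN-toV inz)) adj
  ... | inj₁ (d , c≡c′) = inj₁ (d , toℕ-injective c≡c′)
  ... | inj₂ (r≡r′ , d) = inj₂ (toℕ-injective r≡r′ , d)

  module _ {I : Set} {path : I → ℕ → ℕ × ℕ} {len : I → ℕ} {k : ℕ} where
    open Schedules

    toGrid : Schedule Adjℕ (InRect m n) path len k →
             Schedule Adj (λ _ → ⊤) (λ i t → toV (path i t)) len k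
    toGrid S = record
      { rank                = rank ∘ toN
      ; len≤k               = len≤k
      ; path-in             = λ _ _ _ → tt
      ; path-adjacent       = λ i t t<len → Adjℕ⇒Adj (path-in i t (<⇒≤ t<len)) (path-in i (suc t) t<len)
                                              (path-adjacent i t t<len)
      ; path-covers         = λ v _ →
          let (i , t , t≤len , eq) = path-covers (toN v) (toN-inRect v)
          in  i , t , t≤len , trans (cong toV eq) (toV-toN v)
      ; paths-meet-at-start = λ i i′ t t′ t≤ t′≤ eq →
          paths-meet-at-start i i′ t t′ t≤ t′≤ (toV-injective (path-in i t t≤) (path-in i′ t′ t′≤) eq)
      ; shared-start-fans   = λ i i′ i≢i′ eq x _ adj →
          Sum.map start⇒ (λ (i″ , start≡ , 1≤len , first≡) →
                        i″ , cong toV start≡ , 1≤len , trans (cong toV first≡) (toV-toN x))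
              (shared-start-fans i i′ i≢i′ (toV-injective (path-in i 0 _≤_.z≤n) (path-in i′ 0 _≤_.z≤n) eq)
                                 (toN x) (toN-inRect x) (adj⇒ i 0 _≤_.z≤n adj))
      ; side-rank<          = λ i t t<len sole x _ adj x≢ →
          Sum.map start⇒ (subst (rank (toN x) <_) (sym (cong rank (toN-toV (path-in i (suc t) t<len)))))
              (side-rank< i t t<len (λ t≡0 i′ eq → sole t≡0 i′ (cong toV eq)) (toN x) (toN-inRect x)
                          (adj⇒ i t (<⇒≤ t<len) adj)
                          (λ eq → x≢ (trans (sym (toV-toN x)) (cong toV eq))))
      ; rank-increasing     = λ i t 1≤t t<len →
          subst₂ _<_ (sym (cong rank (toN-toV (path-in i t (<⇒≤ t<len)))))
                     (sym (cong rank (toN-toV (path-in i (suc t) t<len))))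
                 (rank-increasing i t 1≤t t<len)
      ; early-end-covered   = λ i len<k x _ adj →
          subst (λ y → _⊑_ Adj (λ _ → ⊤) (λ i t → toV (path i t)) len y (toV (path i (len i)))) (toV-toN x)
            (⊑-map toV id (λ _ _ → refl) (λ _ → refl) (λ _ → tt)
                   (λ i t t≤len iny adj → Adjℕ⇒Adj (path-in i t t≤len) iny adj)
                   (early-end-covered i len<k (toN x) (toN-inRect x) (adj⇒ i (len i) Data.Nat.Properties.≤-refl adj)))
      }
      where
      open Schedule S
      start⇒ : ∀ {x} → Start Adjℕ (InRect m n) path len (toN x) → Start Adj (λ _ → ⊤) (λ i t → toV (path i t)) len x
      start⇒ {x} (i , eq) = i , trans (cong toV eq) (toV-toN x)
      adj⇒ : ∀ i t {x} → t ≤ len i → Adj (toV (path i t)) x → Adjℕ (path i t) (toN x)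
      adj⇒ i t t≤len adj = subst (λ y → Adjℕ y _) (toN-toV (path-in i t t≤len)) (Adj⇒Adjℕ adj)

-- Grids assembled from a corner

∣n-1+n∣≡1 : ∀ n → ∣ n - suc n ∣ ≡ 1
∣n-1+n∣≡1 zero    = refl
∣n-1+n∣≡1 (suc n) = ∣n-1+n∣≡1 n

∣m-n∣≡1⇒n≡1+m⊎m≡1+n : ∀ m n → ∣ m - n ∣ ≡ 1 → n ≡ suc m ⊎ m ≡ suc n
∣m-n∣≡1⇒n≡1+m⊎m≡1+n zero          (suc zero)    _ = inj₁ refl
∣m-n∣≡1⇒n≡1+m⊎m≡1+n (suc zero)    zero          _ = inj₂ refl
∣m-n∣≡1⇒n≡1+m⊎m≡1+n (suc m)       (suc n)       e = Sum.map (cong suc) (cong suc) (∣m-n∣≡1⇒n≡1+m⊎m≡1+n m n e)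
∣m-n∣≡1⇒n≡1+m⊎m≡1+n zero          zero          ()
∣m-n∣≡1⇒n≡1+m⊎m≡1+n zero          (suc (suc _)) ()
∣m-n∣≡1⇒n≡1+m⊎m≡1+n (suc (suc _)) zero          ()

module _ {d : ℕ} .{{_ : NonZero d}} where

  offset-unique : ∀ {t t′ q q′} → t < d → t′ < d → t + q * d ≡ t′ + q′ * d → t ≡ t′ × q ≡ q′
  offset-unique {t} {t′} {q} {q′} t<d t′<d eq = t≡t′ , *-cancelʳ-≡ q q′ d (+-cancelˡ-≡ t _ _ eq′)
    where
    open ≡-Reasoning
    t≡t′ : t ≡ t′
    t≡t′ = begin
      t                ≡⟨ sym (m<n⇒m%n≡m t<d) ⟩
      t % d            ≡⟨ sym ([m+kn]%n≡m%n t q d) ⟩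
      (t + q * d) % d  ≡⟨ cong (_% d) eq ⟩
      (t′ + q′ * d) % d ≡⟨ [m+kn]%n≡m%n t′ q′ d ⟩
      t′ % d           ≡⟨ m<n⇒m%n≡m t′<d ⟩
      t′               ∎
    eq′ : t + q * d ≡ t + q′ * d
    eq′ = trans eq (cong (_+ q′ * d) (sym t≡t′))

  offset-exists : ∀ {x p} → x < p * d → ∃₂ λ t q → t < d × q < p × x ≡ t + q * d
  offset-exists {x} x<pd = x % d , x / d , m%n<n x d , m<n*o⇒m/o<n x<pd , m≡m%n+[m/n]*n x d

  offset-above : ∀ {x base p} → base ≤ x → x < p * d + base →
                 ∃₂ λ t q → t < d × q < p × t + q * d + base ≡ x
  offset-above {x} {base} base≤x x<pd+base
    with offset-exists {x ∸ base} (+-cancelʳ-< base (x ∸ base) _ (subst (_< _) (sym (m∸n+n≡m base≤x)) x<pd+base))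
  ... | t , q , t<d , q<p , eq = t , q , t<d , q<p , trans (cong (_+ base) (sym eq)) (m∸n+n≡m base≤x)

  offset< : ∀ {t q p} → t < d → q < p → t + q * d < p * d
  offset< {t} {q} {p} t<d q<p = begin-strict
    t + q * d   <⟨ +-monoˡ-< (q * d) t<d ⟩
    d + q * d   ≡⟨⟩
    suc q * d   ≤⟨ *-monoˡ-≤ d q<p ⟩
    p * d       ∎
    where open ≤-Reasoning

leave-rect : ∀ {h w r c r′ c′} → InRect h w (r , c) → ¬ InRect h w (r′ , c′) → Adjℕ (r , c) (r′ , c′) →
             (r′ ≡ h × c′ < w) ⊎ (r′ < h × c′ ≡ w)
leave-rect {h} {w} {r} {c} {r′} {c′} (r<h , c<w) out (inj₁ (d , refl)) with ∣m-n∣≡1⇒n≡1+m⊎m≡1+n r r′ d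
... | inj₂ refl = ⊥-elim (out (<-trans (n<1+n r′) r<h , c<w))
... | inj₁ refl with suc r <? h
... | yes 1+r<h = ⊥-elim (out (1+r<h , c<w))
... | no  1+r≮h = inj₁ (≤-antisym r<h (≮⇒≥ 1+r≮h) , c<w)
leave-rect {h} {w} {r} {c} {r′} {c′} (r<h , c<w) out (inj₂ (refl , d)) with ∣m-n∣≡1⇒n≡1+m⊎m≡1+n c c′ d
... | inj₂ refl = ⊥-elim (out (r<h , <-trans (n<1+n c′) c<w))
... | inj₁ refl with suc c <? w
... | yes 1+c<w = ⊥-elim (out (r<h , 1+c<w))
... | no  1+c≮w = inj₂ (r<h , ≤-antisym c<w (≮⇒≥ 1+c≮w))

beside-rightward : ∀ {r c r′ c′} → Adjℕ (r , c) (r′ , c′) → (r′ , c′) ≢ (r , suc c) →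
                   (r′ ≤ r × c′ ≤ c) ⊎ (r′ ≡ suc r × c′ ≡ c)
beside-rightward {r} {c} {r′} {c′} (inj₁ (d , refl)) _ with ∣m-n∣≡1⇒n≡1+m⊎m≡1+n r r′ d
... | inj₁ refl = inj₂ (refl , refl)
... | inj₂ refl = inj₁ (n≤1+n r′ , ≤-refl)
beside-rightward {r} {c} {r′} {c′} (inj₂ (refl , d)) ≢target with ∣m-n∣≡1⇒n≡1+m⊎m≡1+n c c′ d
... | inj₁ refl = ⊥-elim (≢target refl)
... | inj₂ refl = inj₁ (≤-refl , n≤1+n c′)

beside-downward : ∀ {r c r′ c′} → Adjℕ (r , c) (r′ , c′) → (r′ , c′) ≢ (suc r , c) → r′ ≤ r
beside-downward {r} {c} {r′} {c′} (inj₁ (d , refl)) ≢target with ∣m-n∣≡1⇒n≡1+m⊎m≡1+n r r′ d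
... | inj₁ refl = ⊥-elim (≢target refl)
... | inj₂ refl = n≤1+n r′
beside-downward (inj₂ (refl , _)) _ = ≤-refl

record Corner (k h w : ℕ) : Set where
  field
    size       : ℕ
    path       : Fin size → ℕ → ℕ × ℕ
    len        : Fin size → ℕ
    schedule   : Schedules.Schedule Adjℕ (InRect h w) path len k
    rankBound  : ℕ
    rank≤bound : ∀ y → InRect h w y → Schedules.Schedule.rank schedule y ≤ rankBound

module GridFromCorner (k h w a b : ℕ) (K : Corner k h w) where
  open Corner K using (size) renaming (path to pathK; len to lenK; schedule to SK; rankBound to CK; rank≤bound to rankK≤CK)
  open Schedules.Schedule SK using () renaming
    ( rank to rankK; len≤k to lenK≤k; path-in to pathK-in; path-adjacent to pathK-adjacent; path-covers to pathK-covers
    ; paths-meet-at-start to pathsK-meet-at-start; shared-start-fans to shared-startK-fans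
    ; side-rank< to side-rankK<; rank-increasing to rankK-increasing; early-end-covered to early-endK-covered)
  module C = Schedules Adjℕ (InRect h w) pathK lenK

  d M N : ℕ
  d = suc k
  M = a * d + h
  N = b * d + w

  Index : Set
  Index = Fin size ⊎ (Fin h × Fin b) ⊎ (Fin a × Fin N)

  -- Besides the corner, rows h, h+1, … are cut into vertical segments of d vertices and the
  -- columns w, w+1, … of rows 0, …, h-1 into horizontal ones.
  path : Index → ℕ → ℕ × ℕ
  path (inj₁ ci)               = pathK ci
  path (inj₂ (inj₁ (r , β))) t = toℕ r , t + toℕ β * d + w
  path (inj₂ (inj₂ (α , c))) t = t + toℕ α * d + h , toℕ c

  len : Index → ℕ
  len (inj₁ ci) = lenK ci
  len (inj₂ _)  = k

  data Part : ℕ × ℕ → Set where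
    corner : ∀ {r c} → r < h → c < w → Part (r , c)
    row    : ∀ {r c} → r < h → w ≤ c → Part (r , c)
    column : ∀ {r c} → h ≤ r → Part (r , c)

  part : ∀ y → Part y
  part (r , c) with r <? h | c <? w
  ... | yes r<h | yes c<w = corner r<h c<w
  ... | yes r<h | no  c≮w = row r<h (≮⇒≥ c≮w)
  ... | no  r≮h | _       = column (≮⇒≥ r≮h)

  rankOf : ∀ {y} → Part y → ℕ
  rankOf {y}     (corner _ _) = rankK y
  rankOf {_ , c} (row _ _)    = CK + c
  rankOf {r , _} (column _)   = CK + N + r

  rank : ℕ × ℕ → ℕ
  rank y = rankOf (part y)

  rank-corner : ∀ {r c} → InRect h w (r , c) → rank (r , c) ≡ rankK (r , c)
  rank-corner {r} {c} (r<h , c<w) with part (r , c)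
  ... | corner _ _   = refl
  ... | row _ w≤c    = ⊥-elim (<⇒≱ c<w w≤c)
  ... | column h≤r   = ⊥-elim (<⇒≱ r<h h≤r)

  rank-row : ∀ {r c} → r < h → w ≤ c → rank (r , c) ≡ CK + c
  rank-row {r} {c} r<h w≤c with part (r , c)
  ... | corner _ c<w = ⊥-elim (<⇒≱ c<w w≤c)
  ... | row _ _      = refl
  ... | column h≤r   = ⊥-elim (<⇒≱ r<h h≤r)

  rank-column : ∀ {r c} → h ≤ r → rank (r , c) ≡ CK + N + r
  rank-column {r} {c} h≤r with part (r , c)
  ... | corner r<h _ = ⊥-elim (<⇒≱ r<h h≤r)
  ... | row r<h _    = ⊥-elim (<⇒≱ r<h h≤r)
  ... | column _     = refl

  rank-upper : ∀ {r c} → r < h → rank (r , c) ≤ CK + c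
  rank-upper {r} {c} r<h with part (r , c)
  ... | corner r<h c<w = ≤-trans (rankK≤CK (r , c) (r<h , c<w)) (m≤m+n CK c)
  ... | row _ _        = ≤-refl
  ... | column h≤r     = ⊥-elim (<⇒≱ r<h h≤r)

  rank≤ : ∀ {r c} → c < N → rank (r , c) ≤ CK + N + r
  rank≤ {r} {c} c<N with part (r , c)
  ... | corner r<h c<w = ≤-trans (rankK≤CK (r , c) (r<h , c<w)) (≤-trans (m≤m+n CK N) (m≤m+n (CK + N) r))
  ... | row _ _        = ≤-trans (+-monoʳ-≤ CK (<⇒≤ c<N)) (m≤m+n (CK + N) r)
  ... | column _       = ≤-refl

  module L = Schedules Adjℕ (InRect M N) path len
  open L using (Start; SoleAt; _⊑_)

  inRect-corner : ∀ {y} → InRect h w y → InRect M N y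
  inRect-corner (r<h , c<w) = <-≤-trans r<h (m≤n+m h (a * d)) , <-≤-trans c<w (m≤n+m w (b * d))

  path-in : ∀ i t → t ≤ len i → InRect M N (path i t)
  path-in (inj₁ ci)               t t≤len = inRect-corner (pathK-in ci t t≤len)
  path-in (inj₂ (inj₁ (r , β)))   t t≤k   = <-≤-trans (toℕ<n r) (m≤n+m h (a * d)) , +-monoˡ-< w (offset< (s≤s t≤k) (toℕ<n β))
  path-in (inj₂ (inj₂ (α , c)))   t t≤k   = +-monoˡ-< h (offset< (s≤s t≤k) (toℕ<n α)) , toℕ<n c

  path-adjacent : ∀ i t → t < len i → Adjℕ (path i t) (path i (suc t))
  path-adjacent (inj₁ ci)         t t<len = pathK-adjacent ci t t<len
  path-adjacent (inj₂ (inj₁ (r , β))) t _ = inj₂ (refl , ∣n-1+n∣≡1 (t + toℕ β * d + w))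
  path-adjacent (inj₂ (inj₂ (α , c))) t _ = inj₁ (∣n-1+n∣≡1 (t + toℕ α * d + h) , refl)

  path-covers : ∀ y → InRect M N y → ∃₂ λ i t → t ≤ len i × path i t ≡ y
  path-covers (r , c) (r<M , c<N) with part (r , c)
  ... | corner r<h c<w = let (ci , t , t≤len , eq) = pathK-covers (r , c) (r<h , c<w) in inj₁ ci , t , t≤len , eq
  ... | row r<h w≤c with offset-above w≤c c<N
  ... | t , q , t<d , q<b , eq =
    inj₂ (inj₁ (fromℕ< r<h , fromℕ< q<b)) , t , ≤-pred t<d ,
    cong₂ _,_ (toℕ-fromℕ< r<h) (trans (cong (λ q → t + q * d + w) (toℕ-fromℕ< q<b)) eq)
  path-covers (r , c) (r<M , c<N) | column h≤r with offset-above h≤r r<M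
  ... | t , q , t<d , q<a , eq =
    inj₂ (inj₂ (fromℕ< q<a , fromℕ< c<N)) , t , ≤-pred t<d ,
    cong₂ _,_ (trans (cong (λ q → t + q * d + h) (toℕ-fromℕ< q<a)) eq) (toℕ-fromℕ< c<N)

  IsCorner : Index → Set
  IsCorner i = ∃ λ ci → i ≡ inj₁ ci

  meet-in-corner-or-equal : ∀ i i′ t t′ → t ≤ len i → t′ ≤ len i′ → path i t ≡ path i′ t′ →
                            (IsCorner i × IsCorner i′) ⊎ (i ≡ i′ × t ≡ t′)
  meet-in-corner-or-equal (inj₁ ci) (inj₁ ci′) _ _ _ _ _ = inj₁ ((ci , refl) , (ci′ , refl))
  meet-in-corner-or-equal (inj₁ ci) (inj₂ (inj₁ _)) t _ t≤ _ eq =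
    ⊥-elim (<⇒≱ (proj₂ (pathK-in ci t t≤)) (subst (w ≤_) (sym (cong proj₂ eq)) (m≤n+m w _)))
  meet-in-corner-or-equal (inj₁ ci) (inj₂ (inj₂ _)) t _ t≤ _ eq =
    ⊥-elim (<⇒≱ (proj₁ (pathK-in ci t t≤)) (subst (h ≤_) (sym (cong proj₁ eq)) (m≤n+m h _)))
  meet-in-corner-or-equal (inj₂ (inj₁ _)) (inj₁ ci) _ t′ _ t′≤ eq =
    ⊥-elim (<⇒≱ (proj₂ (pathK-in ci t′ t′≤)) (subst (w ≤_) (cong proj₂ eq) (m≤n+m w _)))
  meet-in-corner-or-equal (inj₂ (inj₂ _)) (inj₁ ci) _ t′ _ t′≤ eq =
    ⊥-elim (<⇒≱ (proj₁ (pathK-in ci t′ t′≤)) (subst (h ≤_) (cong proj₁ eq) (m≤n+m h _)))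
  meet-in-corner-or-equal (inj₂ (inj₁ (r , _))) (inj₂ (inj₂ _)) _ _ _ _ eq =
    ⊥-elim (<⇒≱ (toℕ<n r) (subst (h ≤_) (sym (cong proj₁ eq)) (m≤n+m h _)))
  meet-in-corner-or-equal (inj₂ (inj₂ _)) (inj₂ (inj₁ (r , _))) _ _ _ _ eq =
    ⊥-elim (<⇒≱ (toℕ<n r) (subst (h ≤_) (cong proj₁ eq) (m≤n+m h _)))
  meet-in-corner-or-equal (inj₂ (inj₁ (r , β))) (inj₂ (inj₁ (r′ , β′))) t t′ t≤k t′≤k eq
    with offset-unique (s≤s t≤k) (s≤s t′≤k) (+-cancelʳ-≡ w _ _ (cong proj₂ eq))
  ... | refl , β≡β′ = inj₂ (cong (inj₂ ∘ inj₁) (cong₂ _,_ (toℕ-injective (cong proj₁ eq)) (toℕ-injective β≡β′)) , refl)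
  meet-in-corner-or-equal (inj₂ (inj₂ (α , c))) (inj₂ (inj₂ (α′ , c′))) t t′ t≤k t′≤k eq
    with offset-unique (s≤s t≤k) (s≤s t′≤k) (+-cancelʳ-≡ h _ _ (cong proj₁ eq))
  ... | refl , α≡α′ = inj₂ (cong (inj₂ ∘ inj₂) (cong₂ _,_ (toℕ-injective α≡α′) (toℕ-injective (cong proj₂ eq))) , refl)

  paths-meet-at-start : ∀ i i′ t t′ → t ≤ len i → t′ ≤ len i′ → path i t ≡ path i′ t′ →
                        t ≡ t′ × (t ≡ 0 ⊎ i ≡ i′)
  paths-meet-at-start i i′ t t′ t≤ t′≤ eq with meet-in-corner-or-equal i i′ t t′ t≤ t′≤ eq
  ... | inj₂ (refl , refl) = refl , inj₂ refl
  ... | inj₁ ((ci , refl) , (ci′ , refl)) =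
    let (t≡t′ , where-met) = pathsK-meet-at-start ci ci′ t t′ t≤ t′≤ eq
    in  t≡t′ , Sum.map id (cong inj₁) where-met

  0<quotient : ∀ {base p} → base < p * d + base → 0 < p
  0<quotient {base} {zero}  base<base = ⊥-elim (<-irrefl refl base<base)
  0<quotient {base} {suc p} _         = s≤s z≤n

  column-start : ∀ {c} → h < M → c < N → Start (h , c)
  column-start {c} h<M c<N = inj₂ (inj₂ (fromℕ< 0<a , fromℕ< c<N)) ,
                             cong₂ _,_ (cong (λ q → q * d + h) (toℕ-fromℕ< 0<a)) (toℕ-fromℕ< c<N)
    where
    0<a : 0 < a
    0<a = 0<quotient h<M

  row-start : ∀ {r} → r < h → w < N → Start (r , w)
  row-start {r} r<h w<N = inj₂ (inj₁ (fromℕ< r<h , fromℕ< 0<b)) ,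
                          cong₂ _,_ (toℕ-fromℕ< r<h) (cong (λ q → q * d + w) (toℕ-fromℕ< 0<b))
    where
    0<b : 0 < b
    0<b = 0<quotient w<N

  leave-corner⇒start : ∀ {y z} → InRect h w y → InRect M N z → ¬ InRect h w z → Adjℕ y z → Start z
  leave-corner⇒start iny (r<M , c<N) out adj with leave-rect iny out adj
  ... | inj₁ (refl , _) = column-start r<M c<N
  ... | inj₂ (r<h , refl) = row-start r<h c<N

  corner-start : ∀ {y} → C.Start y → Start y
  corner-start (ci , eq) = inj₁ ci , eq

  shared-start-fans : ∀ i i′ → i ≢ i′ → path i 0 ≡ path i′ 0 → ∀ y → InRect M N y → Adjℕ (path i 0) y →
                      Start y ⊎ ∃ λ i″ → path i″ 0 ≡ path i 0 × 1 ≤ len i″ × path i″ 1 ≡ y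
  shared-start-fans i i′ i≢i′ eq y iny adj with meet-in-corner-or-equal i i′ 0 0 z≤n z≤n eq
  ... | inj₂ (i≡i′ , _) = ⊥-elim (i≢i′ i≡i′)
  ... | inj₁ ((ci , refl) , (ci′ , refl)) with inRect? h w y
  ... | no  out = inj₁ (leave-corner⇒start (pathK-in ci 0 z≤n) iny out adj)
  ... | yes inK = Sum.map corner-start (λ (ci″ , start≡ , 1≤len , first≡) → inj₁ ci″ , start≡ , 1≤len , first≡)
                    (shared-startK-fans ci ci′ (i≢i′ ∘ cong inj₁) eq y inK adj)

  side-rank< : ∀ i t → t < len i → SoleAt i t → ∀ y → InRect M N y → Adjℕ (path i t) y →
               y ≢ path i (suc t) → Start y ⊎ rank y < rank (path i (suc t))
  side-rank< (inj₁ ci) t t<len sole y iny adj y≢ with inRect? h w y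
  ... | no  out = inj₁ (leave-corner⇒start (pathK-in ci t (<⇒≤ t<len)) iny out adj)
  ... | yes inK =
    Sum.map corner-start (subst₂ _<_ (sym (rank-corner inK)) (sym (rank-corner (pathK-in ci (suc t) t<len))))
      (side-rankK< ci t t<len soleK y inK adj y≢)
    where
    soleK : C.SoleAt ci t
    soleK t≡0 ci′ eq = inj₁-injective (sole t≡0 (inj₁ ci′) eq)
      where
      inj₁-injective : ∀ {x y : Fin size} → inj₁ {B = (Fin h × Fin b) ⊎ (Fin a × Fin N)} x ≡ inj₁ y → x ≡ y
      inj₁-injective refl = refl
  side-rank< (inj₂ (inj₁ (r , β))) t _ _ (r′ , c′) (r′<M , c′<N) adj y≢
    with beside-rightward adj y≢
  ... | inj₁ (r′≤r , c′≤c) = inj₂ (begin-strict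
    rank (r′ , c′)          ≤⟨ rank-upper (≤-<-trans r′≤r (toℕ<n r)) ⟩
    CK + c′                 <⟨ +-monoʳ-< CK (s≤s c′≤c) ⟩
    CK + suc c              ≡⟨ sym (rank-row (toℕ<n r) (m≤n+m w _)) ⟩
    rank (toℕ r , suc c)    ∎)
    where
    open ≤-Reasoning
    c = t + toℕ β * d + w
  ... | inj₂ (refl , refl) with m≤n⇒m<n∨m≡n (toℕ<n r)
  ... | inj₂ 1+r≡h = inj₁ (subst (λ r′ → Start (r′ , c′)) (sym 1+r≡h) (column-start (subst (_< M) 1+r≡h r′<M) c′<N))
  ... | inj₁ 1+r<h = inj₂ (begin-strict
    rank (suc (toℕ r) , c′)  ≤⟨ rank-upper 1+r<h ⟩
    CK + c′                  <⟨ +-monoʳ-< CK ≤-refl ⟩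
    CK + suc c′              ≡⟨ sym (rank-row (toℕ<n r) (m≤n+m w _)) ⟩
    rank (toℕ r , suc c′)    ∎)
    where open ≤-Reasoning
  side-rank< (inj₂ (inj₂ (α , c))) t _ _ (r′ , c′) (_ , c′<N) adj y≢ = inj₂ (begin-strict
    rank (r′ , c′)           ≤⟨ rank≤ c′<N ⟩
    CK + N + r′              <⟨ +-monoʳ-< (CK + N) (s≤s (beside-downward adj y≢)) ⟩
    CK + N + suc R           ≡⟨ sym (rank-column (m≤n+m h _)) ⟩
    rank (suc R , toℕ c)     ∎)
    where
    open ≤-Reasoning
    R = t + toℕ α * d + h

  rank-increasing : ∀ i t → 1 ≤ t → t < len i → rank (path i t) < rank (path i (suc t))
  rank-increasing (inj₁ ci) t 1≤t t<len =
    subst₂ _<_ (sym (rank-corner (pathK-in ci t (<⇒≤ t<len)))) (sym (rank-corner (pathK-in ci (suc t) t<len)))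
      (rankK-increasing ci t 1≤t t<len)
  rank-increasing (inj₂ (inj₁ (r , β))) t _ _ =
    subst₂ _<_ (sym (rank-row (toℕ<n r) (m≤n+m w _))) (sym (rank-row (toℕ<n r) (m≤n+m w _))) (+-monoʳ-< CK ≤-refl)
  rank-increasing (inj₂ (inj₂ (α , c))) t _ _ =
    subst₂ _<_ (sym (rank-column (m≤n+m h _))) (sym (rank-column (m≤n+m h _))) (+-monoʳ-< (CK + N) ≤-refl)

  early-end-covered : ∀ i → len i < k → ∀ y → InRect M N y → Adjℕ (path i (len i)) y → y ⊑ path i (len i)
  early-end-covered (inj₂ _)  k<k = ⊥-elim (<-irrefl refl k<k)
  early-end-covered (inj₁ ci) len<k y iny adj with inRect? h w y
  ... | no  out = L.start (leave-corner⇒start (pathK-in ci (lenK ci) ≤-refl) iny out adj)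
  ... | yes inK = ⊑-map id inj₁ (λ _ _ → refl) (λ _ → refl) inRect-corner (λ _ _ _ _ adj → adj)
                    (early-endK-covered ci len<k y inK adj)

  schedule : L.Schedule k
  schedule = record
    { rank                = rank
    ; len≤k               = λ { (inj₁ ci) → lenK≤k ci ; (inj₂ _) → ≤-refl }
    ; path-in             = path-in
    ; path-adjacent       = path-adjacent
    ; path-covers         = path-covers
    ; paths-meet-at-start = paths-meet-at-start
    ; shared-start-fans   = shared-start-fans
    ; side-rank<          = side-rank<
    ; rank-increasing     = rank-increasing
    ; early-end-covered   = early-end-covered
    }

  Fin↔Index : Fin (size + (h * b + a * N)) ↔ Index
  Fin↔Index = (↔-id _ ⊎-↔ ((*↔× ⊎-↔ *↔×) ↔-∘ +↔⊎)) ↔-∘ +↔⊎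

  grid-successful : ∀ {m n} → M ≡ m → N ≡ n → .{{_ : NonZero m}} .{{_ : NonZero n}} →
                    Σ (Fin (size + (h * b + a * N)) → Vtx m n) (Successful k)
  grid-successful refl refl = _ , Play.schedule-wins k (toGrid (reindex Fin↔Index schedule))

-- Verified corners

-- ranks lists the rank of every vertex row by row; a hint lists the intermediate vertices of a
-- ⊑-chain from a neighbour of an early path end to that end.
record CornerData : Set where
  field
    paths : List (List (ℕ × ℕ))
    ranks : List (List ℕ)
    hints : List (List (ℕ × ℕ))

at : {A : Set} → A → List A → ℕ → A
at d []       _       = d
at _ (x ∷ _)  zero    = x
at d (_ ∷ xs) (suc i) = at d xs i

_≟ℕ²_ : DecidableEquality (ℕ × ℕ)
_≟ℕ²_ = ≡-dec ℕ._≟_ ℕ._≟_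

adjℕ? : ∀ y z → Dec (Adjℕ y z)
adjℕ? (r , c) (r′ , c′) = ((∣ r - r′ ∣ ℕ.≟ 1) ×-dec (c ℕ.≟ c′)) ⊎-dec ((r ℕ.≟ r′) ×-dec (∣ c - c′ ∣ ℕ.≟ 1))

module _ {P : ℕ → Set} where

  Fin-∀⇒∀< : ∀ {n} → (∀ (t : Fin n) → P (toℕ t)) → ∀ t → t < n → P t
  Fin-∀⇒∀< f t t<n = subst P (toℕ-fromℕ< t<n) (f (fromℕ< t<n))

  Fin-∀⇒∀≤ : ∀ {n} → (∀ (t : Fin (suc n)) → P (toℕ t)) → ∀ t → t ≤ n → P t
  Fin-∀⇒∀≤ f t t≤n = Fin-∀⇒∀< f t (s≤s t≤n)

Fin²-∀⇒∀-inRect : ∀ {h w} {Q : ℕ × ℕ → Set} → (∀ (r : Fin h) (c : Fin w) → Q (toℕ r , toℕ c)) →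
                  ∀ y → InRect h w y → Q y
Fin²-∀⇒∀-inRect {Q = Q} f (r , c) (r<h , c<w) =
  subst₂ (λ r c → Q (r , c)) (toℕ-fromℕ< r<h) (toℕ-fromℕ< c<w) (f (fromℕ< r<h) (fromℕ< c<w))

module Verify (k h w : ℕ) (D : CornerData) where
  open CornerData D

  size : ℕ
  size = length paths

  path : Fin size → ℕ → ℕ × ℕ
  path ci = at (0 , 0) (lookup paths ci)

  len : Fin size → ℕ
  len ci = length (lookup paths ci) ∸ 1

  rank : ℕ × ℕ → ℕ
  rank (r , c) = at 0 (at [] ranks r) c

  rankBound : ℕ
  rankBound = foldr _⊔_ 0 (concat ranks)

  open Schedules Adjℕ (InRect h w) path len

  start? : ∀ y → Dec (Start y)
  start? y = any? (λ ci → path ci 0 ≟ℕ² y)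

  Link : ℕ × ℕ → ℕ × ℕ → Set
  Link x z = Start x ⊎ ∃₂ λ ci (t : Fin (len ci)) → path ci (suc (toℕ t)) ≡ z ×
                                                   (path ci (toℕ t) ≡ x ⊎ (InRect h w x × Adjℕ (path ci (toℕ t)) x))

  link? : ∀ x z → Dec (Link x z)
  link? x z = start? x ⊎-dec any? λ ci → any? λ t →
    (path ci (suc (toℕ t)) ≟ℕ² z) ×-dec ((path ci (toℕ t) ≟ℕ² x) ⊎-dec (inRect? h w x ×-dec adjℕ? (path ci (toℕ t)) x))

  Link⇒⊑ : ∀ {x z} → Link x z → x ⊑ z
  Link⇒⊑ (inj₁ st) = start st
  Link⇒⊑ (inj₂ (ci , t , refl , inj₁ refl))       = along ci (toℕ t) (toℕ<n t)
  Link⇒⊑ (inj₂ (ci , t , refl , inj₂ (inx , adj))) = beside ci (toℕ t) (toℕ<n t) inx adj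

  Chain : ℕ × ℕ → List (ℕ × ℕ) → ℕ × ℕ → Set
  Chain x []       e = Link x e
  Chain x (z ∷ zs) e = Link x z × Chain z zs e

  chain? : ∀ x zs e → Dec (Chain x zs e)
  chain? x []       e = link? x e
  chain? x (z ∷ zs) e = link? x z ×-dec chain? z zs e

  Chain⇒⊑ : ∀ x zs e → Chain x zs e → x ⊑ e
  Chain⇒⊑ x []       e link           = Link⇒⊑ link
  Chain⇒⊑ x (z ∷ zs) e (link , chain) = ⊑-trans (Link⇒⊑ link) (Chain⇒⊑ z zs e chain)

  SideRankLower : Fin size → ℕ → ℕ × ℕ → Set
  SideRankLower ci t y = Adjℕ (path ci t) y → y ≢ path ci (suc t) → Start y ⊎ rank y < rank (path ci (suc t))

  EndCovered : Fin size → ℕ × ℕ → Set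
  EndCovered ci y = Adjℕ (path ci (len ci)) y → Start y ⊎ Any (λ zs → Chain y zs (path ci (len ci))) hints

  LensBounded PathsInside PathsAdjacent Covering MeetingAtStart SharedStartsFan
    SideRanksLower RanksIncrease RanksBounded EarlyEndsCovered : Set
  LensBounded    = ∀ ci → len ci ≤ k
  PathsInside    = ∀ ci (t : Fin (suc (len ci))) → InRect h w (path ci (toℕ t))
  PathsAdjacent  = ∀ ci (t : Fin (len ci)) → Adjℕ (path ci (toℕ t)) (path ci (suc (toℕ t)))
  Covering       = ∀ (r : Fin h) (c : Fin w) → ∃₂ λ ci (t : Fin (suc (len ci))) → path ci (toℕ t) ≡ (toℕ r , toℕ c)
  MeetingAtStart = ∀ ci ci′ (t : Fin (suc (len ci))) (t′ : Fin (suc (len ci′))) →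
                   path ci (toℕ t) ≡ path ci′ (toℕ t′) → toℕ t ≡ toℕ t′ × (toℕ t ≡ 0 ⊎ ci ≡ ci′)
  SharedStartsFan = ∀ ci ci′ → ci ≢ ci′ → path ci 0 ≡ path ci′ 0 → ∀ (r : Fin h) (c : Fin w) →
                    Adjℕ (path ci 0) (toℕ r , toℕ c) →
                    Start (toℕ r , toℕ c) ⊎ ∃ λ ci″ → path ci″ 0 ≡ path ci 0 × 1 ≤ len ci″ × path ci″ 1 ≡ (toℕ r , toℕ c)
  SideRanksLower = ∀ ci (t : Fin (len ci)) → SoleAt ci (toℕ t) → ∀ (r : Fin h) (c : Fin w) →
                   SideRankLower ci (toℕ t) (toℕ r , toℕ c)
  RanksIncrease  = ∀ ci (t : Fin (len ci)) → 1 ≤ toℕ t → rank (path ci (toℕ t)) < rank (path ci (suc (toℕ t)))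
  RanksBounded   = ∀ (r : Fin h) (c : Fin w) → rank (toℕ r , toℕ c) ≤ rankBound
  EarlyEndsCovered = ∀ ci → len ci < k → ∀ (r : Fin h) (c : Fin w) → EndCovered ci (toℕ r , toℕ c)

  Valid : Set
  Valid = LensBounded × PathsInside × PathsAdjacent × Covering × MeetingAtStart × SharedStartsFan ×
          SideRanksLower × RanksIncrease × RanksBounded × EarlyEndsCovered

  valid? : Dec Valid
  valid? =
    all? (λ ci → len ci ≤? k)
    ×-dec all? (λ ci → all? λ t → inRect? h w (path ci (toℕ t)))
    ×-dec all? (λ ci → all? λ t → adjℕ? (path ci (toℕ t)) (path ci (suc (toℕ t))))
    ×-dec all? (λ r → all? λ c → any? λ ci → any? λ t → path ci (toℕ t) ≟ℕ² (toℕ r , toℕ c))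
    ×-dec all? (λ ci → all? λ ci′ → all? λ t → all? λ t′ → (path ci (toℕ t) ≟ℕ² path ci′ (toℕ t′)) →-dec
            ((toℕ t ℕ.≟ toℕ t′) ×-dec ((toℕ t ℕ.≟ 0) ⊎-dec (ci Fin.≟ ci′))))
    ×-dec all? (λ ci → all? λ ci′ → ¬? (ci Fin.≟ ci′) →-dec ((path ci 0 ≟ℕ² path ci′ 0) →-dec
            all? λ r → all? λ c → adjℕ? (path ci 0) (toℕ r , toℕ c) →-dec (start? (toℕ r , toℕ c) ⊎-dec
              any? λ ci″ → (path ci″ 0 ≟ℕ² path ci 0) ×-dec ((1 ≤? len ci″) ×-dec (path ci″ 1 ≟ℕ² (toℕ r , toℕ c))))))
    ×-dec all? (λ ci → all? λ t → sole? ci (toℕ t) →-dec all? λ r → all? λ c →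
            adjℕ? (path ci (toℕ t)) (toℕ r , toℕ c) →-dec (¬? ((toℕ r , toℕ c) ≟ℕ² path ci (suc (toℕ t))) →-dec
              (start? (toℕ r , toℕ c) ⊎-dec (rank (toℕ r , toℕ c) <? rank (path ci (suc (toℕ t)))))))
    ×-dec all? (λ ci → all? λ t → (1 ≤? toℕ t) →-dec (rank (path ci (toℕ t)) <? rank (path ci (suc (toℕ t)))))
    ×-dec all? (λ r → all? λ c → rank (toℕ r , toℕ c) ≤? rankBound)
    ×-dec all? (λ ci → (len ci <? k) →-dec all? λ r → all? λ c → adjℕ? (path ci (len ci)) (toℕ r , toℕ c) →-dec
            (start? (toℕ r , toℕ c) ⊎-dec Any.any? (λ zs → chain? (toℕ r , toℕ c) zs (path ci (len ci))) hints))
    where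
    sole? : ∀ ci t → Dec (SoleAt ci t)
    sole? ci t = (t ℕ.≟ 0) →-dec all? λ ci′ → (path ci′ 0 ≟ℕ² path ci 0) →-dec (ci′ Fin.≟ ci)

  toCorner : Valid → Corner k h w
  toCorner (lens , inside , adjacent , covering , meeting , fanning , sideRanks , increasing , bounded , earlyEnds) =
    record
    { size       = size
    ; path       = path
    ; len        = len
    ; schedule   = record
      { rank                = rank
      ; len≤k               = lens
      ; path-in             = λ ci → Fin-∀⇒∀≤ (inside ci)
      ; path-adjacent       = λ ci → Fin-∀⇒∀< (adjacent ci)
      ; path-covers         = Fin²-∀⇒∀-inRect λ r c →
          let (ci , t , eq) = covering r c in ci , toℕ t , ≤-pred (toℕ<n t) , eq
      ; paths-meet-at-start = λ ci ci′ t t′ t≤ t′≤ →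
          Fin-∀⇒∀≤ (λ t → Fin-∀⇒∀≤ (meeting ci ci′ t) t′ t′≤) t t≤
      ; shared-start-fans   = λ ci ci′ ci≢ci′ same → Fin²-∀⇒∀-inRect (fanning ci ci′ ci≢ci′ same)
      ; side-rank<          = λ ci t t<len sole →
          Fin-∀⇒∀< {P = λ t → SoleAt ci t → ∀ y → InRect h w y → SideRankLower ci t y}
                   (λ t sole → Fin²-∀⇒∀-inRect (sideRanks ci t sole)) t t<len sole
      ; rank-increasing     = λ ci t 1≤t t<len →
          Fin-∀⇒∀< {P = λ t → 1 ≤ t → rank (path ci t) < rank (path ci (suc t))} (increasing ci) t t<len 1≤t
      ; early-end-covered   = λ ci len<k y iny adj →
          endCovered ci y (Fin²-∀⇒∀-inRect {Q = EndCovered ci} (earlyEnds ci len<k) y iny adj)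
      }
    ; rankBound  = rankBound
    ; rank≤bound = Fin²-∀⇒∀-inRect bounded
    }
    where
    endCovered : ∀ ci y → Start y ⊎ Any (λ zs → Chain y zs (path ci (len ci))) hints → y ⊑ path ci (len ci)
    endCovered ci y (inj₁ st) = start st
    endCovered ci y (inj₂ chained) = let (zs , chain) = satisfied chained in Chain⇒⊑ y zs _ chain

rowCorner : ℕ → CornerData
rowCorner w = record { paths = [ map (0 ,_) (upTo w) ] ; ranks = [ upTo w ] ; hints = [ [] ] }

columnCorner : ℕ → CornerData
columnCorner h = record { paths = [ map (_, 0) (upTo h) ] ; ranks = map [_] (upTo h) ; hints = [ [] ] }

noCorner : CornerData
noCorner = record { paths = [] ; ranks = [] ; hints = [] }

cornerData : ℕ → ℕ → ℕ → CornerData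
cornerData _ 1 w@(suc _) = rowCorner w
cornerData _ h@(suc _) 1 = columnCorner h
cornerData 2 2 5 = record
  { paths = ((0 , 0) ∷ (1 , 0) ∷ (1 , 1) ∷ [])
            ∷ ((0 , 3) ∷ (0 , 2) ∷ (0 , 1) ∷ [])
            ∷ ((1 , 4) ∷ (0 , 4) ∷ [])
            ∷ ((1 , 4) ∷ (1 , 3) ∷ (1 , 2) ∷ [])
            ∷ []
  ; ranks = (0 ∷ 3 ∷ 2 ∷ 0 ∷ 1 ∷ [])
            ∷ (4 ∷ 5 ∷ 2 ∷ 1 ∷ 0 ∷ [])
            ∷ []
  ; hints = []
  }
cornerData 3 2 6 = record
  { paths = ((1 , 0) ∷ (0 , 0) ∷ (0 , 1) ∷ (0 , 2) ∷ [])
            ∷ ((0 , 3) ∷ (0 , 4) ∷ (0 , 5) ∷ (1 , 5) ∷ [])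
            ∷ ((1 , 1) ∷ (1 , 2) ∷ (1 , 3) ∷ (1 , 4) ∷ [])
            ∷ []
  ; ranks = (1 ∷ 2 ∷ 3 ∷ 0 ∷ 5 ∷ 6 ∷ [])
            ∷ (0 ∷ 0 ∷ 3 ∷ 4 ∷ 5 ∷ 7 ∷ [])
            ∷ []
  ; hints = []
  }
cornerData 3 2 7 = record
  { paths = ((0 , 0) ∷ (1 , 0) ∷ (1 , 1) ∷ (1 , 2) ∷ [])
            ∷ ((0 , 0) ∷ (0 , 1) ∷ (0 , 2) ∷ (0 , 3) ∷ [])
            ∷ ((1 , 3) ∷ (1 , 4) ∷ (0 , 4) ∷ (0 , 5) ∷ [])
            ∷ ((1 , 5) ∷ (1 , 6) ∷ (0 , 6) ∷ [])
            ∷ []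
  ; ranks = (0 ∷ 1 ∷ 3 ∷ 4 ∷ 6 ∷ 7 ∷ 9 ∷ [])
            ∷ (1 ∷ 2 ∷ 3 ∷ 0 ∷ 5 ∷ 0 ∷ 8 ∷ [])
            ∷ []
  ; hints = [] ∷ ((1 , 6) ∷ []) ∷ []
  }
cornerData 3 3 6 = record
  { paths = ((0 , 3) ∷ (0 , 2) ∷ (0 , 1) ∷ (0 , 0) ∷ [])
            ∷ ((0 , 4) ∷ (0 , 5) ∷ (1 , 5) ∷ [])
            ∷ ((1 , 0) ∷ (2 , 0) ∷ (2 , 1) ∷ [])
            ∷ ((1 , 4) ∷ (1 , 3) ∷ (1 , 2) ∷ (1 , 1) ∷ [])
            ∷ ((2 , 5) ∷ (2 , 4) ∷ (2 , 3) ∷ (2 , 2) ∷ [])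
            ∷ []
  ; ranks = (7 ∷ 6 ∷ 5 ∷ 0 ∷ 0 ∷ 1 ∷ [])
            ∷ (0 ∷ 6 ∷ 5 ∷ 4 ∷ 0 ∷ 2 ∷ [])
            ∷ (8 ∷ 9 ∷ 5 ∷ 4 ∷ 3 ∷ 0 ∷ [])
            ∷ []
  ; hints = [] ∷ ((2 , 0) ∷ []) ∷ ((1 , 1) ∷ (2 , 0) ∷ []) ∷ [] ∷ []
  }
cornerData 3 3 7 = record
  { paths = ((1 , 0) ∷ (0 , 0) ∷ (0 , 1) ∷ (0 , 2) ∷ [])
            ∷ ((0 , 6) ∷ (0 , 5) ∷ (0 , 4) ∷ (0 , 3) ∷ [])
            ∷ ((2 , 0) ∷ (2 , 1) ∷ (1 , 1) ∷ (1 , 2) ∷ [])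
            ∷ ((2 , 5) ∷ (1 , 5) ∷ (1 , 4) ∷ (1 , 3) ∷ [])
            ∷ ((2 , 5) ∷ (2 , 6) ∷ (1 , 6) ∷ [])
            ∷ ((2 , 5) ∷ (2 , 4) ∷ (2 , 3) ∷ (2 , 2) ∷ [])
            ∷ []
  ; ranks = (8 ∷ 9 ∷ 10 ∷ 5 ∷ 4 ∷ 3 ∷ 0 ∷ [])
            ∷ (0 ∷ 7 ∷ 10 ∷ 5 ∷ 4 ∷ 1 ∷ 2 ∷ [])
            ∷ (0 ∷ 1 ∷ 6 ∷ 5 ∷ 1 ∷ 0 ∷ 1 ∷ [])
            ∷ []
  ; hints = [] ∷ ((2 , 6) ∷ []) ∷ []
  }
cornerData 4 2 7 = record
  { paths = ((0 , 0) ∷ (1 , 0) ∷ (1 , 1) ∷ (1 , 2) ∷ (1 , 3) ∷ [])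
            ∷ ((0 , 1) ∷ (0 , 2) ∷ (0 , 3) ∷ (0 , 4) ∷ (0 , 5) ∷ [])
            ∷ ((1 , 4) ∷ (1 , 5) ∷ (1 , 6) ∷ (0 , 6) ∷ [])
            ∷ []
  ; ranks = (0 ∷ 0 ∷ 3 ∷ 4 ∷ 5 ∷ 6 ∷ 8 ∷ [])
            ∷ (1 ∷ 2 ∷ 3 ∷ 4 ∷ 0 ∷ 6 ∷ 7 ∷ [])
            ∷ []
  ; hints = [] ∷ ((1 , 6) ∷ []) ∷ []
  }
cornerData 4 2 8 = record
  { paths = ((1 , 0) ∷ (0 , 0) ∷ (0 , 1) ∷ [])
            ∷ ((0 , 6) ∷ (0 , 5) ∷ (0 , 4) ∷ (0 , 3) ∷ (0 , 2) ∷ [])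
            ∷ ((0 , 7) ∷ (1 , 7) ∷ (1 , 6) ∷ [])
            ∷ ((1 , 5) ∷ (1 , 4) ∷ (1 , 3) ∷ (1 , 2) ∷ (1 , 1) ∷ [])
            ∷ []
  ; ranks = (8 ∷ 9 ∷ 6 ∷ 5 ∷ 4 ∷ 3 ∷ 0 ∷ 0 ∷ [])
            ∷ (0 ∷ 7 ∷ 6 ∷ 5 ∷ 4 ∷ 0 ∷ 2 ∷ 1 ∷ [])
            ∷ []
  ; hints = ((0 , 0) ∷ []) ∷ ((1 , 1) ∷ (0 , 0) ∷ []) ∷ [] ∷ [] ∷ []
  }
cornerData 4 2 9 = record
  { paths = ((1 , 0) ∷ (0 , 0) ∷ (0 , 1) ∷ (0 , 2) ∷ (0 , 3) ∷ [])
            ∷ ((0 , 4) ∷ (0 , 5) ∷ (0 , 6) ∷ (1 , 6) ∷ (1 , 7) ∷ [])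
            ∷ ((0 , 7) ∷ (0 , 8) ∷ (1 , 8) ∷ [])
            ∷ ((1 , 1) ∷ (1 , 2) ∷ (1 , 3) ∷ (1 , 4) ∷ (1 , 5) ∷ [])
            ∷ []
  ; ranks = (1 ∷ 2 ∷ 3 ∷ 4 ∷ 0 ∷ 6 ∷ 7 ∷ 0 ∷ 10 ∷ [])
            ∷ (0 ∷ 0 ∷ 3 ∷ 4 ∷ 5 ∷ 6 ∷ 8 ∷ 9 ∷ 11 ∷ [])
            ∷ []
  ; hints = [] ∷ ((0 , 8) ∷ []) ∷ []
  }
cornerData 4 3 7 = record
  { paths = ((2 , 2) ∷ (2 , 1) ∷ (2 , 0) ∷ (1 , 0) ∷ (0 , 0) ∷ [])
            ∷ ((0 , 5) ∷ (0 , 4) ∷ (0 , 3) ∷ (0 , 2) ∷ (0 , 1) ∷ [])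
            ∷ ((1 , 6) ∷ (2 , 6) ∷ (2 , 5) ∷ (2 , 4) ∷ (2 , 3) ∷ [])
            ∷ ((1 , 6) ∷ (0 , 6) ∷ [])
            ∷ ((1 , 5) ∷ (1 , 4) ∷ (1 , 3) ∷ (1 , 2) ∷ (1 , 1) ∷ [])
            ∷ []
  ; ranks = (9 ∷ 6 ∷ 5 ∷ 4 ∷ 2 ∷ 0 ∷ 1 ∷ [])
            ∷ (8 ∷ 6 ∷ 5 ∷ 4 ∷ 3 ∷ 0 ∷ 0 ∷ [])
            ∷ (7 ∷ 6 ∷ 0 ∷ 4 ∷ 3 ∷ 2 ∷ 1 ∷ [])
            ∷ []
  ; hints = []
  }
cornerData 4 3 8 = record
  { paths = ((1 , 2) ∷ (1 , 1) ∷ (1 , 0) ∷ (0 , 0) ∷ [])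
            ∷ ((0 , 5) ∷ (0 , 4) ∷ (0 , 3) ∷ (0 , 2) ∷ (0 , 1) ∷ [])
            ∷ ((0 , 6) ∷ (1 , 6) ∷ (1 , 5) ∷ (1 , 4) ∷ (2 , 4) ∷ [])
            ∷ ((0 , 7) ∷ (1 , 7) ∷ (2 , 7) ∷ (2 , 6) ∷ (2 , 5) ∷ [])
            ∷ ((1 , 3) ∷ (2 , 3) ∷ (2 , 2) ∷ (2 , 1) ∷ (2 , 0) ∷ [])
            ∷ []
  ; ranks = (11 ∷ 8 ∷ 7 ∷ 6 ∷ 5 ∷ 0 ∷ 0 ∷ 0 ∷ [])
            ∷ (10 ∷ 9 ∷ 0 ∷ 0 ∷ 5 ∷ 4 ∷ 1 ∷ 1 ∷ [])
            ∷ (10 ∷ 9 ∷ 8 ∷ 7 ∷ 6 ∷ 4 ∷ 3 ∷ 2 ∷ [])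
            ∷ []
  ; hints = [] ∷ ((1 , 0) ∷ []) ∷ []
  }
cornerData 4 3 9 = record
  { paths = ((1 , 1) ∷ (0 , 1) ∷ (0 , 0) ∷ [])
            ∷ ((1 , 5) ∷ (1 , 4) ∷ (1 , 3) ∷ (0 , 3) ∷ (0 , 2) ∷ [])
            ∷ ((1 , 7) ∷ (1 , 6) ∷ (0 , 6) ∷ (0 , 5) ∷ (0 , 4) ∷ [])
            ∷ ((2 , 7) ∷ (2 , 8) ∷ (1 , 8) ∷ (0 , 8) ∷ (0 , 7) ∷ [])
            ∷ ((2 , 7) ∷ (2 , 6) ∷ (2 , 5) ∷ (2 , 4) ∷ (2 , 3) ∷ [])
            ∷ ((1 , 2) ∷ (2 , 2) ∷ (2 , 1) ∷ (2 , 0) ∷ (1 , 0) ∷ [])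
            ∷ []
  ; ranks = (17 ∷ 16 ∷ 11 ∷ 10 ∷ 8 ∷ 7 ∷ 6 ∷ 4 ∷ 3 ∷ [])
            ∷ (15 ∷ 0 ∷ 0 ∷ 9 ∷ 8 ∷ 0 ∷ 5 ∷ 0 ∷ 2 ∷ [])
            ∷ (14 ∷ 13 ∷ 12 ∷ 9 ∷ 7 ∷ 6 ∷ 1 ∷ 0 ∷ 1 ∷ [])
            ∷ []
  ; hints = ((0 , 1) ∷ []) ∷ [] ∷ []
  }
cornerData 4 4 7 = record
  { paths = ((0 , 0) ∷ (0 , 1) ∷ (0 , 2) ∷ (1 , 2) ∷ (1 , 3) ∷ [])
            ∷ ((0 , 3) ∷ (0 , 4) ∷ (1 , 4) ∷ [])
            ∷ ((3 , 6) ∷ (2 , 6) ∷ (1 , 6) ∷ (0 , 6) ∷ (0 , 5) ∷ [])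
            ∷ ((1 , 0) ∷ (2 , 0) ∷ (3 , 0) ∷ (3 , 1) ∷ (3 , 2) ∷ [])
            ∷ ((1 , 1) ∷ (2 , 1) ∷ (2 , 2) ∷ (2 , 3) ∷ (2 , 4) ∷ [])
            ∷ ((3 , 3) ∷ (3 , 4) ∷ (3 , 5) ∷ (2 , 5) ∷ (1 , 5) ∷ [])
            ∷ []
  ; ranks = (0 ∷ 1 ∷ 2 ∷ 0 ∷ 9 ∷ 14 ∷ 13 ∷ [])
            ∷ (0 ∷ 0 ∷ 3 ∷ 8 ∷ 15 ∷ 12 ∷ 12 ∷ [])
            ∷ (1 ∷ 4 ∷ 7 ∷ 8 ∷ 9 ∷ 11 ∷ 11 ∷ [])
            ∷ (5 ∷ 6 ∷ 7 ∷ 0 ∷ 9 ∷ 10 ∷ 0 ∷ [])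
            ∷ []
  ; hints = ((1 , 5) ∷ (0 , 6) ∷ (0 , 5) ∷ []) ∷ [] ∷ ((0 , 6) ∷ (0 , 5) ∷ []) ∷ ((0 , 4) ∷ []) ∷ []
  }
cornerData 4 4 8 = record
  { paths = ((0 , 2) ∷ (1 , 2) ∷ (1 , 3) ∷ (1 , 4) ∷ (1 , 5) ∷ [])
            ∷ ((0 , 2) ∷ (0 , 1) ∷ (0 , 0) ∷ [])
            ∷ ((0 , 3) ∷ (0 , 4) ∷ (0 , 5) ∷ (0 , 6) ∷ (0 , 7) ∷ [])
            ∷ ((1 , 0) ∷ (2 , 0) ∷ (3 , 0) ∷ (3 , 1) ∷ (3 , 2) ∷ [])
            ∷ ((1 , 1) ∷ (2 , 1) ∷ (2 , 2) ∷ (2 , 3) ∷ (3 , 3) ∷ [])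
            ∷ ((2 , 4) ∷ (2 , 5) ∷ (2 , 6) ∷ (1 , 6) ∷ (1 , 7) ∷ [])
            ∷ ((3 , 4) ∷ (3 , 5) ∷ (3 , 6) ∷ (3 , 7) ∷ (2 , 7) ∷ [])
            ∷ []
  ; ranks = (2 ∷ 1 ∷ 0 ∷ 0 ∷ 8 ∷ 9 ∷ 10 ∷ 14 ∷ [])
            ∷ (0 ∷ 0 ∷ 1 ∷ 7 ∷ 8 ∷ 9 ∷ 13 ∷ 14 ∷ [])
            ∷ (3 ∷ 2 ∷ 6 ∷ 7 ∷ 0 ∷ 9 ∷ 10 ∷ 12 ∷ [])
            ∷ (4 ∷ 5 ∷ 6 ∷ 8 ∷ 0 ∷ 9 ∷ 10 ∷ 11 ∷ [])
            ∷ []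
  ; hints = [] ∷ []
  }
cornerData 4 4 9 = record
  { paths = ((0 , 0) ∷ (1 , 0) ∷ (1 , 1) ∷ (2 , 1) ∷ (2 , 2) ∷ [])
            ∷ ((0 , 1) ∷ (0 , 2) ∷ (0 , 3) ∷ (0 , 4) ∷ (1 , 4) ∷ [])
            ∷ ((0 , 5) ∷ (1 , 5) ∷ [])
            ∷ ((2 , 7) ∷ (1 , 7) ∷ (0 , 7) ∷ (0 , 6) ∷ [])
            ∷ ((3 , 7) ∷ (3 , 8) ∷ (2 , 8) ∷ (1 , 8) ∷ (0 , 8) ∷ [])
            ∷ ((1 , 2) ∷ (1 , 3) ∷ (2 , 3) ∷ (2 , 4) ∷ (2 , 5) ∷ [])
            ∷ ((3 , 4) ∷ (3 , 5) ∷ (3 , 6) ∷ (2 , 6) ∷ (1 , 6) ∷ [])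
            ∷ ((2 , 0) ∷ (3 , 0) ∷ (3 , 1) ∷ (3 , 2) ∷ (3 , 3) ∷ [])
            ∷ []
  ; ranks = (0 ∷ 0 ∷ 3 ∷ 4 ∷ 8 ∷ 0 ∷ 18 ∷ 17 ∷ 17 ∷ [])
            ∷ (1 ∷ 2 ∷ 0 ∷ 7 ∷ 9 ∷ 19 ∷ 15 ∷ 16 ∷ 16 ∷ [])
            ∷ (0 ∷ 3 ∷ 6 ∷ 10 ∷ 11 ∷ 12 ∷ 14 ∷ 0 ∷ 15 ∷ [])
            ∷ (4 ∷ 5 ∷ 6 ∷ 7 ∷ 0 ∷ 12 ∷ 13 ∷ 0 ∷ 14 ∷ [])
            ∷ []
  ; hints = ((1 , 6) ∷ (0 , 7) ∷ (0 , 6) ∷ []) ∷ ((0 , 7) ∷ (0 , 6) ∷ []) ∷ ((2 , 5) ∷ (1 , 6) ∷ (0 , 7) ∷ (0 , 6) ∷ []) ∷ ((0 , 7) ∷ []) ∷ [] ∷ []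
  }
cornerData _ _ _ = noCorner

extraBlocks : ℕ → ℕ → ℕ
extraBlocks (suc (suc _)) (suc (suc _)) = 1
extraBlocks _             _             = 0

cornerWidth : ℕ → ℕ → ℕ → ℕ
cornerWidth k rm rn = rn + extraBlocks rm rn * suc k

CornerOK : ℕ → ℕ → ℕ → Set
CornerOK k h w = Verify.Valid k h w (cornerData k h w) × Verify.size k h w (cornerData k h w) ≡ (h * w + k) / suc k

cornerOK? : ∀ k h w → Dec (CornerOK k h w)
cornerOK? k h w = Verify.valid? k h w (cornerData k h w) ×-dec (Verify.size k h w (cornerData k h w) ℕ.≟ (h * w + k) / suc k)

cornerOK : ∀ k → 2 ≤ k → k ≤ 4 → ∀ (rm rn : Fin (suc k)) → CornerOK k (toℕ rm) (cornerWidth k (toℕ rm) (toℕ rn))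
cornerOK 2 _ _ = from-yes (all? λ (rm : Fin 3) → all? λ (rn : Fin 3) → cornerOK? 2 (toℕ rm) (cornerWidth 2 (toℕ rm) (toℕ rn)))
cornerOK 3 _ _ = from-yes (all? λ (rm : Fin 4) → all? λ (rn : Fin 4) → cornerOK? 3 (toℕ rm) (cornerWidth 3 (toℕ rm) (toℕ rn)))
cornerOK 4 _ _ = from-yes (all? λ (rm : Fin 5) → all? λ (rn : Fin 5) → cornerOK? 4 (toℕ rm) (cornerWidth 4 (toℕ rm) (toℕ rn)))
cornerOK 0 () _
cornerOK 1 (s≤s ()) _
cornerOK (suc (suc (suc (suc (suc _))))) _ (s≤s (s≤s (s≤s (s≤s ()))))

verified-corner : ∀ k → 2 ≤ k → k ≤ 4 → ∀ {rm rn} → rm < suc k → rn < suc k → CornerOK k rm (cornerWidth k rm rn)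
verified-corner k 2≤k k≤4 {rm} {rn} rm<d rn<d =
  Fin-∀⇒∀< {P = λ rm → CornerOK k rm (cornerWidth k rm rn)}
    (λ rm → Fin-∀⇒∀< {P = λ rn → CornerOK k (toℕ rm) (cornerWidth k (toℕ rm) rn)} (cornerOK k 2≤k k≤4 rm) rn rn<d)
    rm rm<d

area-split : ∀ k h w a b → let d = suc k ; N = b * d + w in
             ((a * d + h) * N + k) / d ≡ (h * w + k) / d + (h * b + a * N)
area-split k h w a b = begin
  ((a * d + h) * N + k) / d            ≡⟨ cong (_/ d) (expand a d h b w k) ⟩
  ((h * w + k) + X * d) / d            ≡⟨ +-distrib-/-∣ʳ (h * w + k) (n∣m*n X) ⟩
  (h * w + k) / d + X * d / d          ≡⟨ cong ((h * w + k) / d +_) (m*n/n≡m X d) ⟩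
  (h * w + k) / d + X                  ∎
  where
  open ≡-Reasoning
  d = suc k
  N = b * d + w
  X = h * b + a * N
  expand : ∀ a d h b w k → (a * d + h) * (b * d + w) + k ≡ (h * w + k) + (h * b + a * (b * d + w)) * d
  expand = solve-∀

extraBlocks≤1 : ∀ rm rn → extraBlocks rm rn ≤ 1
extraBlocks≤1 (suc (suc _)) (suc (suc _)) = s≤s z≤n
extraBlocks≤1 zero          _             = z≤n
extraBlocks≤1 (suc zero)    _             = z≤n
extraBlocks≤1 (suc (suc _)) zero          = z≤n
extraBlocks≤1 (suc (suc _)) (suc zero)    = z≤n

columns-split : ∀ k rm n → suc k ≤ n →
                (n / suc k ∸ extraBlocks rm (n % suc k)) * suc k + cornerWidth k rm (n % suc k) ≡ n
columns-split k rm n d≤n = begin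
  (n / d ∸ e) * d + (n % d + e * d)  ≡⟨ shuffle (n / d ∸ e) d (n % d) e ⟩
  n % d + ((n / d ∸ e) + e) * d      ≡⟨ cong (λ q → n % d + q * d) (m∸n+n≡m e≤n/d) ⟩
  n % d + n / d * d                  ≡⟨ sym (m≡m%n+[m/n]*n n d) ⟩
  n                                  ∎
  where
  open ≡-Reasoning
  d = suc k
  e = extraBlocks rm (n % d)
  e≤n/d : e ≤ n / d
  e≤n/d = ≤-trans (extraBlocks≤1 rm (n % d)) (m≥n⇒m/n>0 d≤n)
  shuffle : ∀ q d r e → q * d + (r + e * d) ≡ r + (q + e) * d
  shuffle = solve-∀

upper-bound : ∀ k m n → 2 ≤ k → k ≤ 4 → 2 ≤ m → suc k ≤ n →
              Σ (Fin (ceilDivSuc (m * n) k) → Vtx m n) (Successful k)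
upper-bound k m n 2≤k k≤4 2≤m d≤n =
  subst (λ s → Σ (Fin s → Vtx m n) (Successful k)) size≡
        (GridFromCorner.grid-successful k h w a b K rows-split (columns-split k h n d≤n)
                         {{>-nonZero (≤-trans (s≤s z≤n) 2≤m)}} {{>-nonZero (≤-trans (s≤s z≤n) d≤n)}})
  where
  d = suc k
  h = m % d
  w = cornerWidth k h (n % d)
  a = m / d
  b = n / d ∸ extraBlocks h (n % d)
  corner = verified-corner k 2≤k k≤4 (m%n<n m d) (m%n<n n d)
  K = Verify.toCorner k h w (cornerData k h w) (proj₁ corner)

  rows-split : a * d + h ≡ m
  rows-split = trans (+-comm (a * d) h) (sym (m≡m%n+[m/n]*n m d))

  size≡ : Corner.size K + (h * b + a * (b * d + w)) ≡ ceilDivSuc (m * n) k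
  size≡ = begin
    Corner.size K + (h * b + a * (b * d + w))   ≡⟨ cong (_+ (h * b + a * (b * d + w))) (proj₂ corner) ⟩
    (h * w + k) / d + (h * b + a * (b * d + w)) ≡⟨ sym (area-split k h w a b) ⟩
    ((a * d + h) * (b * d + w) + k) / d         ≡⟨ cong₂ (λ m n → (m * n + k) / d) rows-split (columns-split k h n d≤n) ⟩
    (m * n + k) / d                             ∎
    where open ≡-Reasoning

corollary4p16 : (k m n : ℕ) → 2 ≤ k → k ≤ 4 → 2 ≤ m → suc k ≤ n →
    IsDeductionNumber k m n (ceilDivSuc (m * n) k)
corollary4p16 k m n 2≤k k≤4 2≤m d≤n =
  upper-bound k m n 2≤k k≤4 2≤m d≤n , λ s s<d L → <ceilDivSuc⇒unsuccessful k s<d L
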